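{- Let $n \ge 1$ and let $a_1 \le a_2 \le \dots \le a_n$ be integers with $\sum_{i=1}^n a_i = 1$. Let \[ L = \Bigl\{ \lambda=(\lambda_1,\dots,\lambda_n) \in \mathbb{Z}_{\ge 0}^n : \sum_{j=1}^n a_j \lambda_{\pi(j)} \ge 0 \text{ for all } \pi \in S_n \Bigr\} \] and $F(z_1,\dots,z_n) = \sum_{\lambda \in L} z_1^{\lambda_1} z_2^{\lambda_2}\cdots z_n^{\lambda_n}$. For $1 \le i,j \le n$ define \[ b_{i,j} = \begin{cases} 1 & \text{if } j = n,\\ -(a_1+\dots+a_j) & \text{if } n \ge i > j \ge 1,\\ 1-(a_1+\dots+a_j) & \text{if } 1 \le i \le j < n. \end{cases} \] Then \[ F(z_1,\dots,z_n) = \sum_{\pi \in S_n} \frac{\prod_{j \in D_\pi} \bigl(z_{\pi(1)}^{b_{1,j}} z_{\pi(2)}^{b_{2,j}} \cdots z_{\pi(n)}^{b_{n,j}}\bigr)}{\prod_{j=1}^n \bigl(1 - z_{\pi(1)}^{b_{1,j}} z_{\pi(2)}^{b_{2,j}} \cdots z_{\pi(n)}^{b_{n,j}}\bigr)}. \] In particular, $F(q) := F(q,q,\dots,q)$ satisfies \[ F(q) = \frac{\sum_{\pi \in S_n} \prod_{j \in D_\pi} q^{\,j - n\sum_{i=1}^j a_i}}{(1-q^n)\prod_{j=1}^{n-1}\bigl(1 - q^{\,j - n\sum_{i=1}^j a_i}\bigr)}. \]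
   Context: $S_n$ is the symmetric group on $[n]=\{1,\dots,n\}$, a permutation written as $\pi=\pi(1)\pi(2)\cdots\pi(n)$. The descent set of $\pi$ is $D_\pi = \{ j \in \{1,\dots,n-1\} : \pi(j) > \pi(j+1)\}$. Generating functions are formal power series. -}

module Defs where

open import Data.Bool using (Bool; true; false; if_then_else_; _∧_; _∨_; not; T)
open import Data.Nat as ℕ using (ℕ; zero; suc; _≡ᵇ_; _<ᵇ_; _≤ᵇ_; _∸_)
open import Data.Integer as ℤ using (ℤ; +_; -_; _+_; _*_; _-_; 0ℤ; 1ℤ)
open import Data.Fin as Fin using (Fin; toℕ)
open import Data.Vec using (Vec; []; _∷_; lookup)
open import Data.List as List using (List; []; _∷_; allFin; upTo; filterᵇ; length; concatMap; foldr)
open import Data.Bool.ListAction using (all; any)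
open import Data.Product using (Σ; proj₁)
open import Relation.Nullary.Decidable using (⌊_⌋)
open import Function using (_∘_)

-- Indices 1..n of the paper are represented by Fin n = {0,..,n-1}
-- (paper index = toℕ + 1).

sumFin : ∀ {n} → (Fin n → ℤ) → ℤ
sumFin {zero} f = 0ℤ
sumFin {suc n} f = f Fin.zero + sumFin (f ∘ Fin.suc)

Sorted : ∀ {n} → (Fin n → ℤ) → Set
Sorted a = ∀ i j → i Fin.≤ j → a i ℤ.≤ a j

psum : ∀ {n} → (Fin n → ℤ) → Fin n → ℤ
psum a j = sumFin (λ i → if toℕ i ≤ᵇ toℕ j then a i else 0ℤ)

bcoef : ∀ {n} → (Fin n → ℤ) → Fin n → Fin n → ℤ
bcoef {n} a i j =
  if suc (toℕ j) ≡ᵇ n then 1ℤ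
  else (if toℕ j <ᵇ toℕ i then - psum a j else 1ℤ - psum a j)

-- A permutation π ∈ S_n in one-line notation π(1)…π(n): a vector of
-- length n over Fin n with pairwise distinct entries.
isPermᵇ : ∀ {n} → Vec (Fin n) n → Bool
isPermᵇ {n} v =
  all (λ i → all (λ j → (toℕ i ≡ᵇ toℕ j) ∨ not (toℕ (lookup v i) ≡ᵇ toℕ (lookup v j)))
                 (allFin n))
      (allFin n)

Perm : ℕ → Set
Perm n = Σ (Vec (Fin n) n) (λ v → T (isPermᵇ v))

app : ∀ {n} → Perm n → Fin n → Fin n
app π i = lookup (proj₁ π) i

-- j ∈ D_π  (j 0-based): there is a next position j+1 with π(j) > π(j+1)
isDescᵇ : ∀ {n} → Vec (Fin n) n → Fin n → Bool
isDescᵇ {n} v j =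
  any (λ i → (toℕ i ≡ᵇ suc (toℕ j)) ∧ (toℕ (lookup v i) <ᵇ toℕ (lookup v j))) (allFin n)

dind : ∀ {n} → Vec (Fin n) n → Fin n → ℕ
dind v j = if isDescᵇ v j then 1 else 0

InL : ∀ {n} → (Fin n → ℤ) → Vec ℕ n → Set
InL a λv = ∀ π → 0ℤ ℤ.≤ sumFin (λ j → a j * + lookup λv (app π j))

-- exponent of z_v in the monomial z_{π(1)}^{b_{1,j}} ⋯ z_{π(n)}^{b_{n,j}}
monoExp : ∀ {n} → (Fin n → ℤ) → Perm n → Fin n → Fin n → ℤ
monoExp a π j v = sumFin (λ i → if toℕ (app π i) ≡ᵇ toℕ v then bcoef a i j else 0ℤ)

-- z^λ occurs in the expansion of the π-term
--   ∏_{j∈D_π} m_j / ∏_j (1 - m_j) = Σ_{k ∈ ℕⁿ} ∏_j m_j^{k_j + [j ∈ D_π]}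
-- as the term indexed by k.
Rep : ∀ {n} → (Fin n → ℤ) → Perm n → Vec ℕ n → Vec ℕ n → Set
Rep a π k λv =
  ∀ v → + lookup λv v ≡ sumFin (λ j → + (lookup k j ℕ.+ dind (proj₁ π) j) * monoExp a π j v)
  where open import Relation.Binary.PropositionalEquality using (_≡_)

-- Univariate specialisation z₁ = … = zₙ = q : formal power series in q

Series : Set
Series = ℕ → ℤ

sumℤ : List ℤ → ℤ
sumℤ = foldr _+_ 0ℤ

mulS : Series → Series → Series
mulS f g m = sumℤ (List.map (λ i → f i * g (m ∸ i)) (upTo (suc m)))

monoS : ℤ → Series
monoS c m = if ⌊ + m ℤ.≟ c ⌋ then 1ℤ else 0ℤ

oneS : Series
oneS = monoS 0ℤ

oneMinus : ℤ → Series
oneMinus c m = oneS m - monoS c m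

allVecs : ∀ {m} (k : ℕ) → List (Vec (Fin m) k)
allVecs zero = [] ∷ []
allVecs {m} (suc k) = concatMap (λ x → List.map (x ∷_) (allVecs k)) (allFin m)

perms : (n : ℕ) → List (Vec (Fin n) n)
perms n = filterᵇ isPermᵇ (allVecs n)

comps : (k m : ℕ) → List (Vec ℕ k)
comps zero zero = [] ∷ []
comps zero (suc m) = []
comps (suc k) m = concatMap (λ i → List.map (i ∷_) (comps k (m ∸ i))) (upTo (suc m))

inLᵇ : ∀ {n} → (Fin n → ℤ) → Vec ℕ n → Bool
inLᵇ {n} a λv =
  all (λ v → ⌊ 0ℤ ℤ.≤? sumFin (λ j → a j * + lookup λv (lookup v j)) ⌋) (perms n)

Fq : ∀ {n} → (Fin n → ℤ) → Series
Fq {n} a m = + length (filterᵇ (inLᵇ a) (comps n m))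

-- exponent c_j = j - n (a₁+…+a_j)  (paper's 1-based j = toℕ j + 1)
cexp : ∀ {n} → (Fin n → ℤ) → Fin n → ℤ
cexp {n} a j = + suc (toℕ j) - + n * psum a j

numS : ∀ {n} → (Fin n → ℤ) → Series
numS {n} a m =
  sumℤ (List.map (λ v → monoS (sumFin (λ j → + dind v j * cexp a j)) m) (perms n))

denS : ∀ {n} → (Fin n → ℤ) → Series
denS {n} a =
  mulS (oneMinus (+ n))
       (foldr mulS oneS
          (List.map (λ j → oneMinus (cexp a j))
             (filterᵇ (λ j → suc (toℕ j) <ᵇ n) (allFin n))))

module Submission where

-- Let n = N + 1 and c = k + d_π, where d_π is the indicator of the
-- descent set.  The π-term contributes z^λ with λ_{π(i)} = Σⱼ cⱼ b_{i,j}
-- = (μ c)ᵢ.  Because consecutive rows of b differ by unit vectors and the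
-- a-weighted columns of b are (0, …, 0, 1), the map μ is invertible:
-- c_t = λ_{π(t)} − λ_{π(t+1)} and c_last = Σᵢ aᵢ λ_{π(i)}.  For sorted a
-- the prefix sums of a are ≤ 0 (Positivity), so all exponents are ≥ 0 and
-- an exchange argument shows every such λ lies in L.  Conversely, the
-- gaps c ≥ d_π force π to list the positions by decreasing λ, ties by
-- position (Sorting), which gives existence and uniqueness (Bijection).
-- Counting the terms by |λ| = D(π) + Σⱼ kⱼ Cⱼ, with Cⱼ the column sums of
-- b, turns F(q) into Σ_π q^{D(π)} ∏ⱼ 1/(1 − q^{Cⱼ}) (Counting).

open import Defs
open import Data.Nat using (ℕ; _≤_)
open import Data.Integer using (ℤ; 1ℤ)
open import Data.Fin using (Fin)
open import Data.Vec using (Vec)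
open import Data.Product using (Σ; _×_; proj₁)
open import Relation.Nullary using (¬_)
open import Relation.Binary.PropositionalEquality using (_≡_)

open import Data.Bool using (Bool; true; false; if_then_else_; T; _∧_; _∨_; not)
open import Data.Bool.Properties using (T-≡)
open import Data.Bool.ListAction using (all; any; or)
open import Data.Nat as ℕ using (zero; suc; _≡ᵇ_; _<ᵇ_; _≤ᵇ_; _∸_; z≤n; s≤s)
import Data.Nat.Properties as ℕP
open import Data.Integer as ℤ using (+_; -_; _+_; _*_; _-_; 0ℤ; -1ℤ)
import Data.Integer.Properties as ℤP
open import Data.Integer.Tactic.RingSolver using (solve-∀)
open import Data.Fin using (toℕ; inject₁; fromℕ; fromℕ<; punchOut; opposite) renaming (zero to fzero; suc to fsuc)
import Data.Fin.Properties as FinP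
open import Data.Fin.Permutation using (permutation)
open import Data.Vec using ([]; _∷_; lookup; tabulate)
import Data.Vec.Properties as VecP
open import Data.List as List using (List; []; _∷_; _++_; _∷ʳ_; filterᵇ; concatMap; allFin; upTo)
import Data.List.Properties as ListP
open import Data.List.Membership.Propositional using (_∈_; lose; find)
import Data.List.Membership.Propositional.Properties as ∈P
import Data.List.Relation.Unary.All as All
open import Data.List.Relation.Unary.Any using (here; there)
import Data.List.Relation.Unary.All.Properties as AllP
open import Data.Product using (_,_; proj₂)
open import Data.Sum using (_⊎_; inj₁; inj₂)
open import Data.Unit using (tt)
open import Data.Empty using (⊥-elim)
open import Relation.Nullary using (Dec; yes; no; does; proof)
open import Relation.Nullary.Reflects using (Reflects; invert)
open import Relation.Nullary.Decidable using (_⊎-dec_; _×-dec_; dec-true; dec-false; T?; toWitness; fromWitness)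
open import Relation.Binary.PropositionalEquality
  using (refl; sym; trans; cong; cong₂; subst; subst₂; _≢_; module ≡-Reasoning)
open import Relation.Binary.Definitions using (DecidableEquality; tri<; tri≈; tri>)
open import Function using (_∘_; Injective; _⇔_; mk⇔; Equivalence)
open import Algebra.Properties.Semiring.Sum ℤP.+-*-semiring
  using (sum; sum-cong-≗; ∑-distrib-+; ∑-comm; ∑-permute; *-distribˡ-sum; sum-init-last)

T⇒≡true : ∀ {b} → T b → b ≡ true
T⇒≡true = Equivalence.to T-≡

¬T⇒≡false : ∀ {b} → ¬ T b → b ≡ false
¬T⇒≡false {false} _ = refl
¬T⇒≡false {true} h = ⊥-elim (h tt)

≡ᵇ-true : ∀ {m n} → m ≡ n → (m ≡ᵇ n) ≡ true
≡ᵇ-true {m} {n} e = T⇒≡true (ℕP.≡⇒≡ᵇ m n e)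

≡ᵇ-false : ∀ {m n} → m ≢ n → (m ≡ᵇ n) ≡ false
≡ᵇ-false {m} {n} ne = ¬T⇒≡false (ne ∘ ℕP.≡ᵇ⇒≡ m n)

<ᵇ-true : ∀ {m n} → m ℕ.< n → (m <ᵇ n) ≡ true
<ᵇ-true h = T⇒≡true (ℕP.<⇒<ᵇ h)

<ᵇ-false : ∀ {m n} → ¬ (m ℕ.< n) → (m <ᵇ n) ≡ false
<ᵇ-false {m} {n} h = ¬T⇒≡false (h ∘ ℕP.<ᵇ⇒< m n)

≤ᵇ-true : ∀ {m n} → m ≤ n → (m ≤ᵇ n) ≡ true
≤ᵇ-true h = T⇒≡true (ℕP.≤⇒≤ᵇ h)

≤ᵇ-false : ∀ {m n} → ¬ (m ≤ n) → (m ≤ᵇ n) ≡ false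
≤ᵇ-false {m} {n} h = ¬T⇒≡false (h ∘ ℕP.≤ᵇ⇒≤ m n)

sumFin≡sum : ∀ {n} (f : Fin n → ℤ) → sumFin f ≡ sum f
sumFin≡sum {zero} f = refl
sumFin≡sum {suc n} f = cong (λ s → f fzero + s) (sumFin≡sum (f ∘ fsuc))

sumFin-cong : ∀ {n} {f g : Fin n → ℤ} → (∀ i → f i ≡ g i) → sumFin f ≡ sumFin g
sumFin-cong {f = f} {g} h = trans (sumFin≡sum f) (trans (sum-cong-≗ h) (sym (sumFin≡sum g)))

sumFin-+ : ∀ {n} (f g : Fin n → ℤ) → sumFin (λ i → f i + g i) ≡ sumFin f + sumFin g
sumFin-+ f g = trans (sumFin≡sum (λ i → f i + g i))
  (trans (∑-distrib-+ f g) (sym (cong₂ _+_ (sumFin≡sum f) (sumFin≡sum g))))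

sumFin-*ˡ : ∀ {n} (c : ℤ) (f : Fin n → ℤ) → sumFin (λ i → c * f i) ≡ c * sumFin f
sumFin-*ˡ c f = trans (sumFin≡sum (λ i → c * f i)) (trans (sym (*-distribˡ-sum c f)) (cong (c *_) (sym (sumFin≡sum f))))

sumFin-*ʳ : ∀ {n} (c : ℤ) (f : Fin n → ℤ) → sumFin (λ i → f i * c) ≡ sumFin f * c
sumFin-*ʳ c f = trans (sumFin-cong (λ i → ℤP.*-comm (f i) c)) (trans (sumFin-*ˡ c f) (ℤP.*-comm c _))

sumFin-0 : ∀ {n} → sumFin {n} (λ _ → 0ℤ) ≡ 0ℤ
sumFin-0 {zero} = refl
sumFin-0 {suc n} = trans (ℤP.+-identityˡ _) (sumFin-0 {n})

sumFin-- : ∀ {n} (f g : Fin n → ℤ) → sumFin (λ i → f i - g i) ≡ sumFin f - sumFin g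
sumFin-- f g = begin
  sumFin (λ i → f i - g i)          ≡⟨ sumFin-+ f (λ i → - g i) ⟩
  sumFin f + sumFin (λ i → - g i)   ≡⟨ cong (λ s → sumFin f + s) (sumFin-cong (λ i → sym (ℤP.-1*i≡-i (g i)))) ⟩
  sumFin f + sumFin (λ i → -1ℤ * g i) ≡⟨ cong (λ s → sumFin f + s) (trans (sumFin-*ˡ -1ℤ g) (ℤP.-1*i≡-i _)) ⟩
  sumFin f - sumFin g               ∎
  where open ≡-Reasoning

sumFin-swap : ∀ {m n} (f : Fin m → Fin n → ℤ) →
  sumFin (λ i → sumFin (f i)) ≡ sumFin (λ j → sumFin (λ i → f i j))
sumFin-swap f = begin
  sumFin (λ i → sumFin (f i))              ≡⟨ sumFin-cong (λ i → sumFin≡sum (f i)) ⟩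
  sumFin (λ i → sum (f i))                 ≡⟨ sumFin≡sum (λ i → sum (f i)) ⟩
  sum (λ i → sum (f i))                    ≡⟨ ∑-comm f ⟩
  sum (λ j → sum (λ i → f i j))            ≡⟨ sumFin≡sum (λ j → sum (λ i → f i j)) ⟨
  sumFin (λ j → sum (λ i → f i j))         ≡⟨ sumFin-cong (λ j → sumFin≡sum (λ i → f i j)) ⟨
  sumFin (λ j → sumFin (λ i → f i j))      ∎
  where open ≡-Reasoning

sumFin-last : ∀ {N} (f : Fin (suc N) → ℤ) → sumFin f ≡ sumFin (f ∘ inject₁) + f (fromℕ N)
sumFin-last f = trans (sumFin≡sum f)
  (trans (sum-init-last f) (cong (_+ f (fromℕ _)) (sym (sumFin≡sum (f ∘ inject₁)))))

sumFin-const : ∀ {n} (c : ℤ) → sumFin {n} (λ _ → c) ≡ + n * c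
sumFin-const {zero} c = sym (ℤP.*-zeroˡ c)
sumFin-const {suc n} c = trans (cong (λ s → c + s) (sumFin-const {n} c)) (lemma (+ n) c)
  where lemma : ∀ m c → c + m * c ≡ (1ℤ + m) * c
        lemma = solve-∀

sumFin-single : ∀ {n} (f : Fin n → ℤ) (i₀ : Fin n) → (∀ i → i ≢ i₀ → f i ≡ 0ℤ) → sumFin f ≡ f i₀
sumFin-single {suc n} f fzero h =
  trans (cong (λ s → f fzero + s) (trans (sumFin-cong (λ i → h (fsuc i) (λ ()))) (sumFin-0 {n}))) (ℤP.+-identityʳ _)
sumFin-single {suc n} f (fsuc i₀) h =
  trans (cong (_+ sumFin (f ∘ fsuc)) (h fzero (λ ())))
    (trans (ℤP.+-identityˡ _) (sumFin-single (f ∘ fsuc) i₀ (λ i ne → h (fsuc i) (ne ∘ FinP.suc-injective))))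

sumFin-mono : ∀ {n} {f g : Fin n → ℤ} → (∀ i → f i ℤ.≤ g i) → sumFin f ℤ.≤ sumFin g
sumFin-mono {zero} h = ℤP.≤-refl
sumFin-mono {suc n} h = ℤP.+-mono-≤ (h fzero) (sumFin-mono (h ∘ fsuc))

sumFin-nonneg : ∀ {n} (f : Fin n → ℤ) → (∀ i → 0ℤ ℤ.≤ f i) → 0ℤ ℤ.≤ sumFin f
sumFin-nonneg {n} f h = subst (ℤ._≤ sumFin f) (sumFin-0 {n}) (sumFin-mono h)

sumFin-nonpos : ∀ {n} (f : Fin n → ℤ) → (∀ i → f i ℤ.≤ 0ℤ) → sumFin f ℤ.≤ 0ℤ
sumFin-nonpos {n} f h = subst (sumFin f ℤ.≤_) (sumFin-0 {n}) (sumFin-mono h)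

sumFin-term : ∀ {n} (f : Fin n → ℤ) → (∀ i → 0ℤ ℤ.≤ f i) → ∀ i₀ → f i₀ ℤ.≤ sumFin f
sumFin-term {suc n} f h fzero =
  subst (ℤ._≤ sumFin f) (ℤP.+-identityʳ _) (ℤP.+-monoʳ-≤ (f fzero) (sumFin-nonneg (f ∘ fsuc) (h ∘ fsuc)))
sumFin-term {suc n} f h (fsuc i) =
  subst (ℤ._≤ sumFin f) (ℤP.+-identityˡ _) (ℤP.+-mono-≤ (h fzero) (sumFin-term (f ∘ fsuc) (h ∘ fsuc) i))

select : ∀ {n} → Fin n → Fin n → ℤ → ℤ
select x y c = if toℕ x ≡ᵇ toℕ y then c else 0ℤ

select-≡ : ∀ {n} (x : Fin n) c → select x x c ≡ c
select-≡ x c rewrite ≡ᵇ-true {toℕ x} refl = refl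

select-≢ : ∀ {n} {x y : Fin n} c → x ≢ y → select x y c ≡ 0ℤ
select-≢ {x = x} {y} c ne rewrite ≡ᵇ-false (ne ∘ FinP.toℕ-injective {i = x} {y}) = refl

sumFin-select : ∀ {n} (t : Fin n) (c : Fin n → ℤ) → sumFin (λ j → select t j (c j)) ≡ c t
sumFin-select t c = trans (sumFin-single _ t (λ j ne → select-≢ (c j) (ne ∘ sym))) (select-≡ t (c t))

-- Pigeonhole: an injective endomap of Fin n is surjective.  (Abstract,
-- so that the search inside is never unfolded during type checking.)
abstract
  surjective : ∀ {n} (f : Fin n → Fin n) → Injective _≡_ _≡_ f → ∀ u → Σ (Fin n) (λ t → f t ≡ u)
  surjective {zero} f inj ()
  surjective {suc N} f inj u with FinP.any? (λ t → f t FinP.≟ u)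
  ... | yes hit = hit
  ... | no miss = ⊥-elim (ℕP.<-irrefl refl (FinP.injective⇒≤ {f = squeeze} squeeze-injective))
    where
    -- f avoids u, so it factors injectively through Fin N
    avoids : ∀ t → u ≢ f t
    avoids t e = miss (t , sym e)
    squeeze : Fin (suc N) → Fin N
    squeeze t = punchOut (avoids t)
    squeeze-injective : Injective _≡_ _≡_ squeeze
    squeeze-injective e = inj (FinP.punchOut-injective (avoids _) (avoids _) e)

module Inverse {n : ℕ} (f : Fin n → Fin n) (inj : Injective _≡_ _≡_ f) where

  inv : Fin n → Fin n
  inv u = proj₁ (surjective f inj u)

  inv-r : ∀ u → f (inv u) ≡ u
  inv-r u = proj₂ (surjective f inj u)

  inv-l : ∀ t → inv (f t) ≡ t
  inv-l t = inj (inv-r (f t))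

  inv-injective : Injective _≡_ _≡_ inv
  inv-injective {x} {y} e = trans (sym (inv-r x)) (trans (cong f e) (inv-r y))

  sumFin-reindex : (g : Fin n → ℤ) → sumFin (g ∘ f) ≡ sumFin g
  sumFin-reindex g = begin
    sumFin (g ∘ f)  ≡⟨ sumFin≡sum (g ∘ f) ⟩
    sum (g ∘ f)     ≡⟨ ∑-permute g (permutation f inv inv-r inv-l) ⟨
    sum g           ≡⟨ sumFin≡sum g ⟨
    sumFin g        ∎
    where open ≡-Reasoning

open Inverse public

sumFin-select-injective : ∀ {n} (f : Fin n → Fin n) → Injective _≡_ _≡_ f →
  ∀ i₀ (g : Fin n → ℤ) → sumFin (λ i → select (f i) (f i₀) (g i)) ≡ g i₀
sumFin-select-injective f inj i₀ g =
  trans (sumFin-single _ i₀ (λ i ne → select-≢ (g i) (ne ∘ inj))) (select-≡ (f i₀) (g i₀))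

T-all-allFin : ∀ {n} (p : Fin n → Bool) → T (all p (allFin n)) ⇔ (∀ i → T (p i))
T-all-allFin {n} p = mk⇔
  (λ h i → All.lookup (AllP.all⁺ p (allFin n) h) (∈P.∈-allFin i))
  (λ h → AllP.all⁻ p {xs = allFin n} (All.tabulate (λ {i} _ → h i)))

isPerm⇒injective : ∀ {n} (v : Vec (Fin n) n) → T (isPermᵇ v) → Injective _≡_ _≡_ (lookup v)
isPerm⇒injective v h {i} {j} e
  with Equivalence.to (T-all-allFin _) (Equivalence.to (T-all-allFin _) h i) j
... | distinct rewrite ≡ᵇ-true (cong toℕ e) with toℕ i ≡ᵇ toℕ j in i≡j
...   | true = FinP.toℕ-injective (ℕP.≡ᵇ⇒≡ _ _ (subst T (sym i≡j) tt))

injective⇒isPerm : ∀ {n} (v : Vec (Fin n) n) → Injective _≡_ _≡_ (lookup v) → T (isPermᵇ v)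
injective⇒isPerm v inj =
  Equivalence.from (T-all-allFin _) (λ i → Equivalence.from (T-all-allFin _) (distinct i))
  where
  same-index : ∀ i j → toℕ (lookup v i) ≡ toℕ (lookup v j) → T (toℕ i ≡ᵇ toℕ j)
  same-index i j e = ℕP.≡⇒≡ᵇ _ _ (cong toℕ (inj (FinP.toℕ-injective e)))
  distinct : ∀ i j → T ((toℕ i ≡ᵇ toℕ j) ∨ not (toℕ (lookup v i) ≡ᵇ toℕ (lookup v j)))
  distinct i j with toℕ i ≡ᵇ toℕ j in i≡j
  ... | true = tt
  ... | false rewrite ≡ᵇ-false {toℕ (lookup v i)} {toℕ (lookup v j)} (λ e → subst T i≡j (same-index i j e)) = tt

perm-injective : ∀ {n} (π : Perm n) → Injective _≡_ _≡_ (app π)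
perm-injective π = isPerm⇒injective (proj₁ π) (proj₂ π)

vec-ext : ∀ {A : Set} {m} (v w : Vec A m) → (∀ i → lookup v i ≡ lookup w i) → v ≡ w
vec-ext v w h = trans (sym (VecP.tabulate∘lookup v)) (trans (VecP.tabulate-cong h) (VecP.tabulate∘lookup w))

data LastView {N : ℕ} : Fin (suc N) → Set where
  last  : LastView (fromℕ N)
  inner : (t : Fin N) → LastView (inject₁ t)

lastView : ∀ {N} (j : Fin (suc N)) → LastView j
lastView {zero} fzero = last
lastView {suc N} fzero = inner fzero
lastView {suc N} (fsuc j) with lastView j
... | last = last
... | inner t = inner (fsuc t)

lastView-last : ∀ {N} → lastView {N} (fromℕ N) ≡ last
lastView-last {zero} = refl
lastView-last {suc N} rewrite lastView-last {N} = refl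

lastView-inner : ∀ {N} (t : Fin N) → lastView (inject₁ t) ≡ inner t
lastView-inner {suc N} fzero = refl
lastView-inner {suc N} (fsuc t) rewrite lastView-inner t = refl

inject₁≢suc : ∀ {N} (t : Fin N) → inject₁ t ≢ fsuc t
inject₁≢suc t e = ℕP.1+n≢n (sym (trans (sym (FinP.toℕ-inject₁ t)) (cong toℕ e)))

any-single : ∀ {n} (p : Fin n → Bool) (i₀ : Fin n) → (∀ i → i ≢ i₀ → p i ≡ false) →
  any p (allFin n) ≡ p i₀
any-single {n} p i₀ h = trans (cong or (ListP.map-tabulate {n = n} (λ i → i) p)) (or-tabulate p i₀ h)
  where
  or-tabulate : ∀ {m} (q : Fin m → Bool) (i₀ : Fin m) → (∀ i → i ≢ i₀ → q i ≡ false) →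
    or (List.tabulate q) ≡ q i₀
  or-tabulate q fzero h with q fzero
  ... | true = refl
  ... | false = none (q ∘ fsuc) (λ i → h (fsuc i) (λ ()))
    where
    none : ∀ {m} (q : Fin m → Bool) → (∀ i → q i ≡ false) → or (List.tabulate q) ≡ false
    none {zero} q h = refl
    none {suc m} q h rewrite h fzero = none (q ∘ fsuc) (h ∘ fsuc)
  or-tabulate q (fsuc i₀) h rewrite h fzero (λ ()) =
    or-tabulate (q ∘ fsuc) i₀ (λ i ne → h (fsuc i) (ne ∘ FinP.suc-injective))

dind-last : ∀ {N} (v : Vec (Fin (suc N)) (suc N)) → dind v (fromℕ N) ≡ 0
dind-last {N} v = cong (λ b → if b then 1 else 0) (trans (any-single _ (fromℕ N) (λ i _ → never i)) (never (fromℕ N)))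
  where
  never : ∀ i → ((toℕ i ≡ᵇ suc (toℕ (fromℕ N))) ∧ (toℕ (lookup v i) <ᵇ toℕ (lookup v (fromℕ N)))) ≡ false
  never i rewrite FinP.toℕ-fromℕ N | ≡ᵇ-false (λ e → ℕP.<-irrefl e (FinP.toℕ<n i)) = refl

descent : ∀ {N} (v : Vec (Fin (suc N)) (suc N)) (t : Fin N) → Bool
descent v t = toℕ (lookup v (fsuc t)) <ᵇ toℕ (lookup v (inject₁ t))

dind-inner : ∀ {N} (v : Vec (Fin (suc N)) (suc N)) t → dind v (inject₁ t) ≡ (if descent v t then 1 else 0)
dind-inner v t = cong (λ b → if b then 1 else 0) (trans (any-single _ (fsuc t) other) at-next)
  where
  at-next : ((suc (toℕ t) ≡ᵇ suc (toℕ (inject₁ t))) ∧ descent v t) ≡ descent v t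
  at-next rewrite FinP.toℕ-inject₁ t | ≡ᵇ-true {toℕ t} refl = refl
  other : ∀ i → i ≢ fsuc t →
    ((toℕ i ≡ᵇ suc (toℕ (inject₁ t))) ∧ (toℕ (lookup v i) <ᵇ toℕ (lookup v (inject₁ t)))) ≡ false
  other i ne rewrite FinP.toℕ-inject₁ t | ≡ᵇ-false {toℕ i} {suc (toℕ t)} (ne ∘ FinP.toℕ-injective) = refl

atMost : ∀ {m} → ℕ → Fin m → ℤ
atMost k i = if k <ᵇ toℕ i then 0ℤ else 1ℤ

count-atMost : ∀ {m} k → k ℕ.< m → sumFin {m} (atMost k) ≡ + suc k
count-atMost {suc m} zero _ = cong (λ s → 1ℤ + s) (sumFin-0 {m})
count-atMost {suc m} (suc k) (s≤s k<m) = cong (λ s → 1ℤ + s) (count-atMost {m} k k<m)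

chain-constant : ∀ {N} (δ : Fin (suc N) → ℤ) → (∀ t → δ (inject₁ t) ≡ δ (fsuc t)) → ∀ i → δ i ≡ δ fzero
chain-constant δ h fzero = refl
chain-constant {suc N} δ h (fsuc i) = trans (chain-constant (δ ∘ fsuc) (h ∘ fsuc) i) (sym (h fzero))

count : ∀ {m} → (Fin m → Bool) → ℕ
count {zero} p = 0
count {suc m} p = (if p fzero then 1 else 0) ℕ.+ count (p ∘ fsuc)

count≡sumFin : ∀ {m} (p : Fin m → Bool) → + count p ≡ sumFin (λ i → if p i then 1ℤ else 0ℤ)
count≡sumFin {zero} p = refl
count≡sumFin {suc m} p with p fzero
... | true = cong (λ x → 1ℤ + x) (count≡sumFin (p ∘ fsuc))
... | false = trans (count≡sumFin (p ∘ fsuc)) (sym (ℤP.+-identityˡ _))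

count-bounded : ∀ {m} (p : Fin m → Bool) → count p ≤ m
count-bounded {zero} p = z≤n
count-bounded {suc m} p with p fzero
... | true = s≤s (count-bounded (p ∘ fsuc))
... | false = ℕP.m≤n⇒m≤1+n (count-bounded (p ∘ fsuc))

count-< : ∀ {m} (p : Fin m → Bool) i → p i ≡ false → count p ℕ.< m
count-< {suc m} p fzero pᵢ rewrite pᵢ = s≤s (count-bounded (p ∘ fsuc))
count-< {suc m} p (fsuc i) pᵢ with p fzero
... | true = s≤s (count-< (p ∘ fsuc) i pᵢ)
... | false = ℕP.m≤n⇒m≤1+n (count-< (p ∘ fsuc) i pᵢ)

Implies : ∀ {m} → (Fin m → Bool) → (Fin m → Bool) → Set
Implies p q = ∀ i → p i ≡ true → q i ≡ true

count-mono : ∀ {m} (p q : Fin m → Bool) → Implies p q → count p ≤ count q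
count-mono {zero} p q p⇒q = z≤n
count-mono {suc m} p q p⇒q with p fzero in p₀ | q fzero in q₀
... | true | true = s≤s (count-mono (p ∘ fsuc) (q ∘ fsuc) (p⇒q ∘ fsuc))
... | true | false = ⊥-elim (true≢false (trans (sym (p⇒q fzero p₀)) q₀))
  where true≢false : true ≢ false
        true≢false ()
... | false | true = ℕP.m≤n⇒m≤1+n (count-mono (p ∘ fsuc) (q ∘ fsuc) (p⇒q ∘ fsuc))
... | false | false = count-mono (p ∘ fsuc) (q ∘ fsuc) (p⇒q ∘ fsuc)

count-mono-< : ∀ {m} (p q : Fin m → Bool) → Implies p q →
  ∀ i → p i ≡ false → q i ≡ true → count p ℕ.< count q
count-mono-< {suc m} p q p⇒q fzero pᵢ qᵢ rewrite pᵢ | qᵢ = s≤s (count-mono (p ∘ fsuc) (q ∘ fsuc) (p⇒q ∘ fsuc))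
count-mono-< {suc m} p q p⇒q (fsuc i) pᵢ qᵢ with p fzero in p₀ | q fzero in q₀
... | true | true = s≤s (count-mono-< (p ∘ fsuc) (q ∘ fsuc) (p⇒q ∘ fsuc) i pᵢ qᵢ)
... | true | false = ⊥-elim (true≢false (trans (sym (p⇒q fzero p₀)) q₀))
  where true≢false : true ≢ false
        true≢false ()
... | false | true = ℕP.m≤n⇒m≤1+n (count-mono-< (p ∘ fsuc) (q ∘ fsuc) (p⇒q ∘ fsuc) i pᵢ qᵢ)
... | false | false = count-mono-< (p ∘ fsuc) (q ∘ fsuc) (p⇒q ∘ fsuc) i pᵢ qᵢ

count-below : ∀ {m} k → k ≤ m → sumFin {m} (λ t → if toℕ t <ᵇ k then 1ℤ else 0ℤ) ≡ + k
count-below {m} zero _ = sumFin-0 {m}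
count-below {suc m} (suc k) (s≤s k≤m) = cong (λ x → 1ℤ + x) (count-below {m} k k≤m)

chain : ∀ {X : Set} (R : X → X → Set) → (∀ {x y z} → R x y → R y z → R x z) →
  ∀ {N} (f : Fin (suc N) → X) → (∀ t → R (f (inject₁ t)) (f (fsuc t))) →
  ∀ x y → toℕ x ℕ.< toℕ y → R (f x) (f y)
chain R trans′ f step fzero (fsuc fzero) _ = step fzero
chain R trans′ {suc N} f step fzero (fsuc (fsuc y)) _ =
  trans′ (step fzero) (chain R trans′ (f ∘ fsuc) (step ∘ fsuc) fzero (fsuc y) (s≤s z≤n))
chain R trans′ {suc N} f step (fsuc x) (fsuc y) (s≤s x<y) = chain R trans′ (f ∘ fsuc) (step ∘ fsuc) x y x<y

-- For weights w : Fin n → ℕ, list the positions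
-- by decreasing weight, breaking ties by increasing position.  The listing
-- order ≺ is a strict total order; the rank of u (number of positions before
-- it) is injective, and inverting it gives the unique ≺-increasing
-- permutation.

module Sorting {N : ℕ} (w : Fin (suc N) → ℕ) where

  _≺_ : Fin (suc N) → Fin (suc N) → Set
  u ≺ v = (w v ℕ.< w u) ⊎ (w u ≡ w v × toℕ u ℕ.< toℕ v)

  _≺?_ : ∀ u v → Dec (u ≺ v)
  u ≺? v = (w v ℕP.<? w u) ⊎-dec ((w u ℕP.≟ w v) ×-dec (toℕ u ℕP.<? toℕ v))

  ≺-irrefl : ∀ {u} → ¬ (u ≺ u)
  ≺-irrefl (inj₁ w<w) = ℕP.<-irrefl refl w<w
  ≺-irrefl (inj₂ (_ , u<u)) = ℕP.<-irrefl refl u<u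

  ≺-trans : ∀ {x y z} → x ≺ y → y ≺ z → x ≺ z
  ≺-trans (inj₁ p) (inj₁ q) = inj₁ (ℕP.<-trans q p)
  ≺-trans {x} (inj₁ p) (inj₂ (e , _)) = inj₁ (subst (ℕ._< w x) e p)
  ≺-trans {z = z} (inj₂ (e , _)) (inj₁ q) = inj₁ (subst (w z ℕ.<_) (sym e) q)
  ≺-trans (inj₂ (e , p)) (inj₂ (e′ , q)) = inj₂ (trans e e′ , ℕP.<-trans p q)

  ≺⇒≥ : ∀ {u v} → u ≺ v → w v ≤ w u
  ≺⇒≥ (inj₁ lt) = ℕP.<⇒≤ lt
  ≺⇒≥ (inj₂ (e , _)) = ℕP.≤-reflexive (sym e)

  ≺⇒> : ∀ {u v} → u ≺ v → toℕ v ℕ.< toℕ u → w v ℕ.< w u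
  ≺⇒> (inj₁ lt) _ = lt
  ≺⇒> (inj₂ (_ , u<v)) v<u = ⊥-elim (ℕP.<-asym u<v v<u)

  ≺-asym : ∀ {x y} → x ≺ y → ¬ (y ≺ x)
  ≺-asym p q = ≺-irrefl (≺-trans p q)

  ≺-total : ∀ u v → u ≢ v → (u ≺ v) ⊎ (v ≺ u)
  ≺-total u v u≢v with ℕP.<-cmp (w u) (w v)
  ... | tri< lt _ _ = inj₂ (inj₁ lt)
  ... | tri> _ _ gt = inj₁ (inj₁ gt)
  ... | tri≈ _ e _ with ℕP.<-cmp (toℕ u) (toℕ v)
  ...   | tri< lt _ _ = inj₁ (inj₂ (e , lt))
  ...   | tri≈ _ e′ _ = ⊥-elim (u≢v (FinP.toℕ-injective e′))
  ...   | tri> _ _ gt = inj₂ (inj₂ (sym e , gt))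

  before : Fin (suc N) → Fin (suc N) → Bool
  before u v = does (v ≺? u)

  before-true : ∀ {u v} → v ≺ u → before u v ≡ true
  before-true {u} {v} = dec-true (v ≺? u)

  before-false : ∀ {u v} → ¬ (v ≺ u) → before u v ≡ false
  before-false {u} {v} = dec-false (v ≺? u)

  before-sound : ∀ {u v} → before u v ≡ true → v ≺ u
  before-sound {u} {v} e = invert (subst (Reflects (v ≺ u)) e (proof (v ≺? u)))

  rank : Fin (suc N) → ℕ
  rank u = count (before u)

  rank-mono : ∀ {u v} → u ≺ v → rank u ℕ.< rank v
  rank-mono {u} {v} u≺v = count-mono-< (before u) (before v)
    (λ x e → before-true (≺-trans (before-sound e) u≺v)) u (before-false ≺-irrefl) (before-true u≺v)

  rankᶠ : Fin (suc N) → Fin (suc N)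
  rankᶠ u = fromℕ< (count-< (before u) u (before-false ≺-irrefl))

  toℕ-rankᶠ : ∀ u → toℕ (rankᶠ u) ≡ rank u
  toℕ-rankᶠ u = FinP.toℕ-fromℕ< _

  rankᶠ-injective : Injective _≡_ _≡_ rankᶠ
  rankᶠ-injective {u} {v} e with u FinP.≟ v
  ... | yes u≡v = u≡v
  ... | no u≢v with ≺-total u v u≢v
  ...   | inj₁ u≺v = ⊥-elim (ℕP.<-irrefl (same-rank) (rank-mono u≺v))
    where same-rank = trans (sym (toℕ-rankᶠ u)) (trans (cong toℕ e) (toℕ-rankᶠ v))
  ...   | inj₂ v≺u = ⊥-elim (ℕP.<-irrefl (same-rank) (rank-mono v≺u))
    where same-rank = trans (sym (toℕ-rankᶠ v)) (trans (cong toℕ (sym e)) (toℕ-rankᶠ u))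

  Increasing : Perm (suc N) → Set
  Increasing π = ∀ t → app π (inject₁ t) ≺ app π (fsuc t)

  rank-increasing : ∀ π → Increasing π → ∀ i → rank (app π i) ≡ toℕ i
  rank-increasing π incr i = ℤP.+-injective (begin
    + rank (app π i)
      ≡⟨ count≡sumFin (before (app π i)) ⟩
    sumFin (λ v → if before (app π i) v then 1ℤ else 0ℤ)
      ≡⟨ sumFin-reindex (app π) (perm-injective π) (λ v → if before (app π i) v then 1ℤ else 0ℤ) ⟨
    sumFin (λ t → if before (app π i) (app π t) then 1ℤ else 0ℤ)
      ≡⟨ sumFin-cong precedes ⟩
    sumFin {suc N} (λ t → if toℕ t <ᵇ toℕ i then 1ℤ else 0ℤ)
      ≡⟨ count-below {suc N} (toℕ i) (ℕP.<⇒≤ (FinP.toℕ<n i)) ⟩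
    + toℕ i ∎)
    where
    open ≡-Reasoning
    ordered : ∀ x y → toℕ x ℕ.< toℕ y → app π x ≺ app π y
    ordered = chain _≺_ ≺-trans (app π) incr
    precedes : ∀ t → (if before (app π i) (app π t) then 1ℤ else 0ℤ) ≡ (if toℕ t <ᵇ toℕ i then 1ℤ else 0ℤ)
    precedes t with ℕP.<-cmp (toℕ t) (toℕ i)
    ... | tri< t<i _ _ rewrite before-true (ordered t i t<i) | <ᵇ-true t<i = refl
    ... | tri≈ _ t≡i _ rewrite FinP.toℕ-injective t≡i | before-false {app π i} {app π i} ≺-irrefl
                             | <ᵇ-false {toℕ i} {toℕ i} (ℕP.<-irrefl refl) = refl
    ... | tri> _ _ i<t rewrite before-false (≺-asym (ordered i t i<t)) | <ᵇ-false {toℕ t} {toℕ i} (ℕP.<⇒≯ i<t) = refl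

  increasing-unique : ∀ π π′ → Increasing π → Increasing π′ → proj₁ π ≡ proj₁ π′
  increasing-unique π π′ incr incr′ = vec-ext (proj₁ π) (proj₁ π′) agree
    where
    inj′ = perm-injective π′
    agree : ∀ i → app π i ≡ app π′ i
    agree i = trans (sym (inv-r (app π′) inj′ (app π i))) (cong (app π′) t≡i)
      where
      t = inv (app π′) inj′ (app π i)
      t≡i : t ≡ i
      t≡i = FinP.toℕ-injective (trans (sym (rank-increasing π′ incr′ t))
              (trans (cong rank (inv-r (app π′) inj′ (app π i))) (rank-increasing π incr i)))

  unrank : Fin (suc N) → Fin (suc N)
  unrank = inv rankᶠ rankᶠ-injective

  sorter : Perm (suc N)
  sorter = tabulate unrank , injective⇒isPerm (tabulate unrank) lookup-injective
    where
    lookup-injective : Injective _≡_ _≡_ (lookup (tabulate unrank))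
    lookup-injective {x} {y} e = inv-injective rankᶠ rankᶠ-injective
      (trans (sym (VecP.lookup∘tabulate unrank x)) (trans e (VecP.lookup∘tabulate unrank y)))

  rank-sorter : ∀ i → rank (app sorter i) ≡ toℕ i
  rank-sorter i = trans (sym (toℕ-rankᶠ (app sorter i)))
    (cong toℕ (trans (cong rankᶠ (VecP.lookup∘tabulate unrank i)) (inv-r rankᶠ rankᶠ-injective i)))

  sorter-increasing : Increasing sorter
  sorter-increasing t = ordered (≺-total x y (inject₁≢suc t ∘ perm-injective sorter))
    where
    x = app sorter (inject₁ t)
    y = app sorter (fsuc t)
    ordered : (x ≺ y) ⊎ (y ≺ x) → x ≺ y
    ordered (inj₁ x≺y) = x≺y
    ordered (inj₂ y≺x) = ⊥-elim (ℕP.<-asym inverted (ℕP.≤-<-trans (ℕP.≤-reflexive (FinP.toℕ-inject₁ t)) (ℕP.n<1+n (toℕ t))))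
      where
      inverted : suc (toℕ t) ℕ.< toℕ (inject₁ t)
      inverted = subst₂ ℕ._<_ (rank-sorter (fsuc t)) (rank-sorter (inject₁ t)) (rank-mono y≺x)

sumL : ∀ {A : Set} → List A → (A → ℤ) → ℤ
sumL xs f = sumℤ (List.map f xs)

Σ< : (ℕ → ℤ) → ℕ → ℤ
Σ< f k = sumFin {k} (f ∘ toℕ)

sumL-applyUpTo : ∀ (g : ℕ → ℕ) k (f : ℕ → ℤ) → sumL (List.applyUpTo g k) f ≡ Σ< (f ∘ g) k
sumL-applyUpTo g zero f = refl
sumL-applyUpTo g (suc k) f = cong (λ x → f (g 0) + x) (sumL-applyUpTo (g ∘ suc) k f)

Σ<-cong : ∀ {f g : ℕ → ℤ} k → (∀ i → i ℕ.< k → f i ≡ g i) → Σ< f k ≡ Σ< g k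
Σ<-cong k h = sumFin-cong (λ i → h (toℕ i) (FinP.toℕ<n i))

Σ<-zero : ∀ {f : ℕ → ℤ} k → (∀ i → i ℕ.< k → f i ≡ 0ℤ) → Σ< f k ≡ 0ℤ
Σ<-zero k h = trans (Σ<-cong k h) (sumFin-0 {k})

Σ<-reverse : ∀ (f : ℕ → ℤ) k → Σ< f (suc k) ≡ Σ< (λ i → f (k ∸ i)) (suc k)
Σ<-reverse f k = trans (sym (sumFin-reindex opposite opposite-injective (f ∘ toℕ)))
                       (sumFin-cong (λ i → cong f (FinP.opposite-prop i)))
  where
  opposite-injective : Injective _≡_ _≡_ (opposite {suc k})
  opposite-injective {x} {y} e =
    trans (sym (FinP.opposite-involutive x)) (trans (cong opposite e) (FinP.opposite-involutive y))

Σ<-extend : ∀ (f : ℕ → ℤ) k k′ → k ≤ k′ → (∀ i → k ≤ i → f i ≡ 0ℤ) → Σ< f k′ ≡ Σ< f k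
Σ<-extend f zero k′ _ h = Σ<-zero k′ (λ i _ → h i z≤n)
Σ<-extend f (suc k) (suc k′) (s≤s k≤k′) h =
  cong (λ x → f 0 + x) (Σ<-extend (f ∘ suc) k k′ k≤k′ (λ i k≤i → h (suc i) (s≤s k≤i)))

Σ<-single : ∀ (f : ℕ → ℤ) k i₀ → i₀ ℕ.< k → (∀ i → i ≢ i₀ → f i ≡ 0ℤ) → Σ< f k ≡ f i₀
Σ<-single f k i₀ i₀<k h =
  trans (sumFin-single (f ∘ toℕ) (fromℕ< i₀<k) (λ i ne → h (toℕ i) (λ e → ne (FinP.toℕ-injective (trans e (sym at)))))) (cong f at)
  where at = FinP.toℕ-fromℕ< i₀<k

infix 4 _≗ₛ_
_≗ₛ_ : Series → Series → Set
f ≗ₛ g = ∀ m → f m ≡ g m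

≗ₛ-trans : ∀ {f g h : Series} → f ≗ₛ g → g ≗ₛ h → f ≗ₛ h
≗ₛ-trans p q m = trans (p m) (q m)

≗ₛ-sym : ∀ {f g : Series} → f ≗ₛ g → g ≗ₛ f
≗ₛ-sym p m = sym (p m)

infixl 7 _⊛_
_⊛_ : Series → Series → Series
(f ⊛ g) m = Σ< (λ i → f i * g (m ∸ i)) (suc m)

mulS≗⊛ : ∀ f g → mulS f g ≗ₛ f ⊛ g
mulS≗⊛ f g m = sumL-applyUpTo (λ i → i) (suc m) (λ i → f i * g (m ∸ i))

⊛-cong : ∀ {f f′ g g′} → f ≗ₛ f′ → g ≗ₛ g′ → f ⊛ g ≗ₛ f′ ⊛ g′
⊛-cong hf hg m = Σ<-cong (suc m) (λ i _ → cong₂ _*_ (hf i) (hg (m ∸ i)))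

⊛-distribʳ-+ : ∀ f f′ g m → ((λ i → f i + f′ i) ⊛ g) m ≡ (f ⊛ g) m + (f′ ⊛ g) m
⊛-distribʳ-+ f f′ g m =
  trans (Σ<-cong {g = λ i → f i * g (m ∸ i) + f′ i * g (m ∸ i)} (suc m) (λ i _ → ℤP.*-distribʳ-+ (g (m ∸ i)) (f i) (f′ i)))
        (sumFin-+ {suc m} (λ i → f (toℕ i) * g (m ∸ toℕ i)) (λ i → f′ (toℕ i) * g (m ∸ toℕ i)))

⊛-scaleˡ : ∀ c f g m → ((λ i → c * f i) ⊛ g) m ≡ c * (f ⊛ g) m
⊛-scaleˡ c f g m =
  trans (Σ<-cong {g = λ i → c * (f i * g (m ∸ i))} (suc m) (λ i _ → ℤP.*-assoc c (f i) (g (m ∸ i))))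
        (sumFin-*ˡ {suc m} c (λ i → f (toℕ i) * g (m ∸ toℕ i)))

⊛-zeroˡ : ∀ f g → (∀ i → f i ≡ 0ℤ) → ∀ m → (f ⊛ g) m ≡ 0ℤ
⊛-zeroˡ f g h m = Σ<-zero {f = λ i → f i * g (m ∸ i)} (suc m) (λ i _ → cong (_* g (m ∸ i)) (h i))

⊛-comm : ∀ f g → f ⊛ g ≗ₛ g ⊛ f
⊛-comm f g m = trans (Σ<-reverse (λ i → f i * g (m ∸ i)) m)
  (Σ<-cong (suc m) (λ i i≤m → trans (cong (λ j → f (m ∸ i) * g j) (ℕP.m∸[m∸n]≡n (ℕP.≤-pred i≤m)))
                                    (ℤP.*-comm (f (m ∸ i)) (g i))))

⊛-assoc : ∀ f g h → (f ⊛ g) ⊛ h ≗ₛ f ⊛ (g ⊛ h)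
⊛-assoc f g h zero = regroup (f 0) (g 0) (h 0)
  where regroup : ∀ a b c → (a * b + 0ℤ) * c + 0ℤ ≡ a * (b * c + 0ℤ) + 0ℤ
        regroup = solve-∀
⊛-assoc f g h (suc m) =
  trans (cong (λ x → (f ⊛ g) 0 * h (suc m) + x) tail-step)
        (regroup (f 0) (g 0) (h (suc m)) (((g ∘ suc) ⊛ h) m) (((f ∘ suc) ⊛ (g ⊛ h)) m))
  where
  -- peeling off the constant term of f: (f ⊛ g)(i+1) = f₀ g_{i+1} + ((f ∘ suc)
  -- ⊛ g) i
  tail-step : (((f ⊛ g) ∘ suc) ⊛ h) m ≡ f 0 * ((g ∘ suc) ⊛ h) m + ((f ∘ suc) ⊛ (g ⊛ h)) m
  tail-step = trans (⊛-distribʳ-+ (λ i → f 0 * g (suc i)) ((f ∘ suc) ⊛ g) h m)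
                    (cong₂ _+_ (⊛-scaleˡ (f 0) (g ∘ suc) h m) (⊛-assoc (f ∘ suc) g h m))
  regroup : ∀ a b c x y → (a * b + 0ℤ) * c + (a * x + y) ≡ a * (b * c + x) + y
  regroup = solve-∀

monoS-δ : ∀ i c → monoS (+ c) i ≡ (if i ≡ᵇ c then 1ℤ else 0ℤ)
monoS-δ i c with i ℕP.≟ c
... | yes refl = cong (λ b → if b then 1ℤ else 0ℤ) (sym (≡ᵇ-true {i} refl))
... | no i≢c = cong (λ b → if b then 1ℤ else 0ℤ) (sym (≡ᵇ-false i≢c))

⊛-mono : ∀ c g m → (monoS (+ c) ⊛ g) m ≡ (if c ≤ᵇ m then g (m ∸ c) else 0ℤ)
⊛-mono c g m = trans (⊛-cong {g = g} (λ i → monoS-δ i c) (λ _ → refl) m) (shift c m)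
  where
  ≤ᵇ-suc : ∀ c m → (suc c ≤ᵇ suc m) ≡ (c ≤ᵇ m)
  ≤ᵇ-suc zero m = refl
  ≤ᵇ-suc (suc c) m = refl
  shift : ∀ c m → ((λ i → if i ≡ᵇ c then 1ℤ else 0ℤ) ⊛ g) m ≡ (if c ≤ᵇ m then g (m ∸ c) else 0ℤ)
  shift zero zero = trans (ℤP.+-identityʳ (1ℤ * g 0)) (ℤP.*-identityˡ (g 0))
  shift zero (suc m) = trans (cong₂ _+_ (ℤP.*-identityˡ (g (suc m)))
                                      (⊛-zeroˡ (λ i → if suc i ≡ᵇ 0 then 1ℤ else 0ℤ) g (λ _ → refl) m))
                             (ℤP.+-identityʳ (g (suc m)))
  shift (suc c) zero = refl
  shift (suc c) (suc m) = trans (ℤP.+-identityˡ _) (trans (shift c m) (cong (λ b → if b then g (m ∸ c) else 0ℤ) (sym (≤ᵇ-suc c m))))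

oneS-⊛ : ∀ g → oneS ⊛ g ≗ₛ g
oneS-⊛ g m = ⊛-mono 0 g m

⊛-oneS : ∀ g → g ⊛ oneS ≗ₛ g
⊛-oneS g m = trans (⊛-comm g oneS m) (oneS-⊛ g m)

oneMinus-⊛ : ∀ c g m → (oneMinus (+ c) ⊛ g) m ≡ g m - (if c ≤ᵇ m then g (m ∸ c) else 0ℤ)
oneMinus-⊛ c g m = begin
  (oneMinus (+ c) ⊛ g) m
    ≡⟨ ⊛-cong {g = g} (λ i → cong (λ x → oneS i + x) (sym (ℤP.-1*i≡-i (monoS (+ c) i)))) (λ _ → refl) m ⟩
  ((λ i → oneS i + -1ℤ * monoS (+ c) i) ⊛ g) m
    ≡⟨ ⊛-distribʳ-+ oneS (λ i → -1ℤ * monoS (+ c) i) g m ⟩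
  (oneS ⊛ g) m + ((λ i → -1ℤ * monoS (+ c) i) ⊛ g) m
    ≡⟨ cong₂ _+_ (oneS-⊛ g m) (trans (⊛-scaleˡ -1ℤ (monoS (+ c)) g m) (ℤP.-1*i≡-i _)) ⟩
  g m - (monoS (+ c) ⊛ g) m
    ≡⟨ cong (λ x → g m - x) (⊛-mono c g m) ⟩
  g m - (if c ≤ᵇ m then g (m ∸ c) else 0ℤ) ∎
  where open ≡-Reasoning

≤ᵇ-shift : ∀ w x m → w ≤ m → (w ℕ.+ x ≤ᵇ m) ≡ (x ≤ᵇ m ∸ w)
≤ᵇ-shift w x m w≤m with x ℕP.≤? m ∸ w
... | yes x≤ = trans (≤ᵇ-true (subst (w ℕ.+ x ≤_) (ℕP.m+[n∸m]≡n w≤m) (ℕP.+-monoʳ-≤ w x≤))) (sym (≤ᵇ-true x≤))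
... | no x≰ = trans (≤ᵇ-false (λ le → x≰ (ℕP.+-cancelˡ-≤ w x (m ∸ w) (subst (w ℕ.+ x ≤_) (sym (ℕP.m+[n∸m]≡n w≤m)) le))))
                   (sym (≤ᵇ-false x≰))

multiple-exceeds : ∀ c r t → 1 ≤ c → suc r ≤ t → (t ℕ.* c ≤ᵇ r) ≡ false
multiple-exceeds c r t c≥1 r<t =
  ≤ᵇ-false (λ tc≤r → ℕP.<-irrefl refl (ℕP.<-≤-trans r<t (ℕP.≤-trans (ℕP.m≤m*n t c {{ℕ.>-nonZero c≥1}}) tc≤r)))

-- geometric c X = X / (1 − q^c): its m-th coefficient is Σ_{t·c ≤ m} X (m −
-- t·c).
geometric : ℕ → Series → Series
geometric c X m = Σ< (λ t → if t ℕ.* c ≤ᵇ m then X (m ∸ t ℕ.* c) else 0ℤ) (suc m)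

geometric-rec : ∀ c X m → 1 ≤ c → geometric c X m ≡ X m + (if c ≤ᵇ m then geometric c X (m ∸ c) else 0ℤ)
geometric-rec c X m c≥1 with c ℕP.≤? m
... | yes c≤m rewrite ≤ᵇ-true c≤m = cong (λ x → X m + x) (trans (Σ<-cong m (λ t _ → shifted t)) extend)
  where
  r = m ∸ c
  h : ℕ → ℤ
  h t = if t ℕ.* c ≤ᵇ r then X (r ∸ t ℕ.* c) else 0ℤ
  shifted : ∀ t → (if c ℕ.+ t ℕ.* c ≤ᵇ m then X (m ∸ (c ℕ.+ t ℕ.* c)) else 0ℤ) ≡ h t
  shifted t rewrite ≤ᵇ-shift c (t ℕ.* c) m c≤m | ℕP.∸-+-assoc m c (t ℕ.* c) = refl
  extend : Σ< h m ≡ geometric c X r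
  extend = Σ<-extend h (suc r) m (subst (suc r ≤_) (ℕP.m+[n∸m]≡n c≤m) (ℕP.+-monoˡ-≤ r c≥1))
             (λ t r<t → cong (λ b → if b then X (r ∸ t ℕ.* c) else 0ℤ) (multiple-exceeds c r t c≥1 r<t))
... | no c≰m rewrite ≤ᵇ-false c≰m = cong (λ x → X m + x) (Σ<-zero m (λ t _ → vanishes t))
  where
  vanishes : ∀ t → (if c ℕ.+ t ℕ.* c ≤ᵇ m then X (m ∸ (c ℕ.+ t ℕ.* c)) else 0ℤ) ≡ 0ℤ
  vanishes t rewrite ≤ᵇ-false {c ℕ.+ t ℕ.* c} {m} (λ le → c≰m (ℕP.≤-trans (ℕP.m≤m+n c (t ℕ.* c)) le)) = refl

oneMinus-geometric : ∀ c X → 1 ≤ c → oneMinus (+ c) ⊛ geometric c X ≗ₛ X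
oneMinus-geometric c X c≥1 m =
  trans (oneMinus-⊛ c (geometric c X) m)
        (trans (cong (λ x → x - (if c ≤ᵇ m then geometric c X (m ∸ c) else 0ℤ)) (geometric-rec c X m c≥1)) (cancel _ _))
  where cancel : ∀ x y → x + y - y ≡ x
        cancel = solve-∀

-- ∏_{c ∈ cs} 1 / (1 − q^c)
geometrics : List ℕ → Series
geometrics [] = oneS
geometrics (c ∷ cs) = geometric c (geometrics cs)

prodS : List Series → Series
prodS = List.foldr mulS oneS

prodS-cong : ∀ {A : Set} (xs : List A) (F F′ : A → Series) → (∀ x → F x ≗ₛ F′ x) →
  prodS (List.map F xs) ≗ₛ prodS (List.map F′ xs)
prodS-cong [] F F′ h = λ _ → refl
prodS-cong (x ∷ xs) F F′ h =
  ≗ₛ-trans (mulS≗⊛ (F x) _) (≗ₛ-trans (⊛-cong (h x) (prodS-cong xs F F′ h)) (≗ₛ-sym (mulS≗⊛ (F′ x) _)))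

geometrics-inverse : ∀ {A : Set} (xs : List A) (g : A → ℕ) → (∀ x → 1 ≤ g x) →
  geometrics (List.map g xs) ⊛ prodS (List.map (λ x → oneMinus (+ g x)) xs) ≗ₛ oneS
geometrics-inverse [] g pos = ⊛-oneS oneS
geometrics-inverse (x ∷ xs) g pos =
  ≗ₛ-trans (⊛-cong {f = P} (λ _ → refl) (mulS≗⊛ (oneMinus (+ g x)) R))
  (≗ₛ-trans (≗ₛ-sym (⊛-assoc P (oneMinus (+ g x)) R))
  (≗ₛ-trans (⊛-cong {g = R} (≗ₛ-trans (⊛-comm P (oneMinus (+ g x))) (oneMinus-geometric (g x) P′ (pos x))) (λ _ → refl))
  (geometrics-inverse xs g pos)))
  where
  P = geometrics (List.map g (x ∷ xs))
  P′ = geometrics (List.map g xs)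
  R = prodS (List.map (λ x → oneMinus (+ g x)) xs)

prodS-snoc : ∀ {A : Set} (xs : List A) (y : A) (F : A → Series) →
  prodS (List.map F (xs ∷ʳ y)) ≗ₛ F y ⊛ prodS (List.map F xs)
prodS-snoc [] y F = mulS≗⊛ (F y) oneS
prodS-snoc (x ∷ xs) y F =
  ≗ₛ-trans (mulS≗⊛ (F x) _)
  (≗ₛ-trans (⊛-cong {f = F x} (λ _ → refl) (prodS-snoc xs y F))
  (≗ₛ-trans (≗ₛ-sym (⊛-assoc (F x) (F y) R))
  (≗ₛ-trans (⊛-cong {g = R} (⊛-comm (F x) (F y)) (λ _ → refl))
  (≗ₛ-trans (⊛-assoc (F y) (F x) R)
  (⊛-cong {f = F y} (λ _ → refl) (≗ₛ-sym (mulS≗⊛ (F x) R)))))))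
  where R = prodS (List.map F xs)

-- Coefficients are computed in Defs by filtering and counting lists of
-- vectors.  We count through 0/1 indicators: every vector of the right
-- shape occurs exactly once in each of these lists.

[_]ᵇ : Bool → ℤ
[ b ]ᵇ = if b then 1ℤ else 0ℤ

[∧] : ∀ b c → [ b ∧ c ]ᵇ ≡ [ b ]ᵇ * [ c ]ᵇ
[∧] true true = refl
[∧] true false = refl
[∧] false c = sym (ℤP.*-zeroˡ [ c ]ᵇ)

𝟙 : ∀ {P : Set} → Dec P → ℤ
𝟙 d = [ does d ]ᵇ

𝟙-yes : ∀ {P : Set} (d : Dec P) → P → 𝟙 d ≡ 1ℤ
𝟙-yes d p = cong [_]ᵇ (dec-true d p)

𝟙-no : ∀ {P : Set} (d : Dec P) → ¬ P → 𝟙 d ≡ 0ℤ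
𝟙-no d ¬p = cong [_]ᵇ (dec-false d ¬p)

𝟙-⇔ : ∀ {P Q : Set} (p? : Dec P) (q? : Dec Q) → (P → Q) → (Q → P) → 𝟙 p? ≡ 𝟙 q?
𝟙-⇔ (yes p) q? to from = sym (𝟙-yes q? (to p))
𝟙-⇔ (no ¬p) q? to from = sym (𝟙-no q? (¬p ∘ from))

module _ {A : Set} where

  sumL-cong∈ : ∀ (xs : List A) {f g : A → ℤ} → (∀ x → x ∈ xs → f x ≡ g x) → sumL xs f ≡ sumL xs g
  sumL-cong∈ [] h = refl
  sumL-cong∈ (x ∷ xs) h = cong₂ _+_ (h x (here refl)) (sumL-cong∈ xs (λ y y∈ → h y (there y∈)))

  sumL-cong : ∀ (xs : List A) {f g : A → ℤ} → (∀ x → f x ≡ g x) → sumL xs f ≡ sumL xs g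
  sumL-cong xs h = sumL-cong∈ xs (λ x _ → h x)

  sumL-0 : ∀ (xs : List A) → sumL xs (λ _ → 0ℤ) ≡ 0ℤ
  sumL-0 [] = refl
  sumL-0 (x ∷ xs) = trans (ℤP.+-identityˡ _) (sumL-0 xs)

  sumL-++ : ∀ (xs ys : List A) f → sumL (xs ++ ys) f ≡ sumL xs f + sumL ys f
  sumL-++ [] ys f = sym (ℤP.+-identityˡ _)
  sumL-++ (x ∷ xs) ys f = trans (cong (λ s → f x + s) (sumL-++ xs ys f)) (sym (ℤP.+-assoc (f x) _ _))

  sumL-+ : ∀ (xs : List A) f g → sumL xs (λ x → f x + g x) ≡ sumL xs f + sumL xs g
  sumL-+ [] f g = refl
  sumL-+ (x ∷ xs) f g = trans (cong (λ s → f x + g x + s) (sumL-+ xs f g)) (interchange (f x) (g x) _ _)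
    where interchange : ∀ a b c d → (a + b) + (c + d) ≡ (a + c) + (b + d)
          interchange = solve-∀

  sumL-*ˡ : ∀ (xs : List A) c f → sumL xs (λ x → c * f x) ≡ c * sumL xs f
  sumL-*ˡ [] c f = sym (ℤP.*-zeroʳ c)
  sumL-*ˡ (x ∷ xs) c f = trans (cong (λ s → c * f x + s) (sumL-*ˡ xs c f)) (sym (ℤP.*-distribˡ-+ c _ _))

  sumL-filter : ∀ (xs : List A) p f → sumL (filterᵇ p xs) f ≡ sumL xs (λ x → if p x then f x else 0ℤ)
  sumL-filter [] p f = refl
  sumL-filter (x ∷ xs) p f with p x
  ... | true = cong (λ s → f x + s) (sumL-filter xs p f)
  ... | false = trans (sumL-filter xs p f) (sym (ℤP.+-identityˡ _))

  length-filter : ∀ (xs : List A) p → + List.length (filterᵇ p xs) ≡ sumL xs (λ x → [ p x ]ᵇ)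
  length-filter [] p = refl
  length-filter (x ∷ xs) p with p x
  ... | true = cong (λ s → 1ℤ + s) (length-filter xs p)
  ... | false = trans (length-filter xs p) (sym (ℤP.+-identityˡ _))

sumL-map : ∀ {A B : Set} (xs : List A) (h : A → B) (f : B → ℤ) → sumL (List.map h xs) f ≡ sumL xs (f ∘ h)
sumL-map xs h f = cong sumℤ (sym (ListP.map-∘ xs))

sumL-concatMap : ∀ {A B : Set} (xs : List A) (h : A → List B) (f : B → ℤ) →
  sumL (concatMap h xs) f ≡ sumL xs (λ x → sumL (h x) f)
sumL-concatMap [] h f = refl
sumL-concatMap (x ∷ xs) h f = trans (sumL-++ (h x) (concatMap h xs) f) (cong (λ s → sumL (h x) f + s) (sumL-concatMap xs h f))

sumL-swap : ∀ {A B : Set} (xs : List A) (ys : List B) (f : A → B → ℤ) →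
  sumL xs (λ x → sumL ys (f x)) ≡ sumL ys (λ y → sumL xs (λ x → f x y))
sumL-swap [] ys f = sym (sumL-0 ys)
sumL-swap (x ∷ xs) ys f =
  trans (cong (λ s → sumL ys (f x) + s) (sumL-swap xs ys f)) (sym (sumL-+ ys (f x) (λ y → sumL xs (λ x′ → f x′ y))))

sumL-cons-indicator : ∀ {A : Set} {k} (_≟_ : DecidableEquality A) (xs : List A) (ws : A → List (Vec A k)) (v₀ : A) (v : Vec A k) →
  sumL xs (λ x → sumL (List.map (x ∷_) (ws x)) (λ w → 𝟙 (VecP.≡-dec _≟_ w (v₀ ∷ v))))
    ≡ sumL xs (λ x → 𝟙 (x ≟ v₀) * sumL (ws x) (λ w → 𝟙 (VecP.≡-dec _≟_ w v)))
sumL-cons-indicator _≟_ xs ws v₀ v = sumL-cong xs (λ x →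
  trans (sumL-map (ws x) (x ∷_) _)
        (trans (sumL-cong (ws x) (λ w → [∧] (does (x ≟ v₀)) (does (VecP.≡-dec _≟_ w v))))
               (sumL-*ˡ (ws x) (𝟙 (x ≟ v₀)) (λ w → 𝟙 (VecP.≡-dec _≟_ w v)))))

sumL-tabulate : ∀ {B : Set} {m} (g : Fin m → B) (f : B → ℤ) → sumL (List.tabulate g) f ≡ sumFin (f ∘ g)
sumL-tabulate {m = zero} g f = refl
sumL-tabulate {m = suc m} g f = cong (λ s → f (g fzero) + s) (sumL-tabulate (g ∘ fsuc) f)

sumℕ : ∀ {m} → (Fin m → ℕ) → ℕ
sumℕ {zero} f = 0
sumℕ {suc m} f = f fzero ℕ.+ sumℕ (f ∘ fsuc)

sumℕ≡sumFin : ∀ {m} (f : Fin m → ℕ) → + sumℕ f ≡ sumFin (λ i → + f i)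
sumℕ≡sumFin {zero} f = refl
sumℕ≡sumFin {suc m} f = trans (ℤP.pos-+ (f fzero) _) (cong (λ s → + f fzero + s) (sumℕ≡sumFin (f ∘ fsuc)))

sumℕ-term : ∀ {m} (f : Fin m → ℕ) i → f i ≤ sumℕ f
sumℕ-term {suc m} f fzero = ℕP.m≤m+n _ _
sumℕ-term {suc m} f (fsuc i) = ℕP.≤-trans (sumℕ-term (f ∘ fsuc) i) (ℕP.m≤n+m _ _)

_≟ᶠ_ : ∀ {m k} → DecidableEquality (Vec (Fin m) k)
_≟ᶠ_ = VecP.≡-dec FinP._≟_

_≟ⁿ_ : ∀ {k} → DecidableEquality (Vec ℕ k)
_≟ⁿ_ = VecP.≡-dec ℕP._≟_

sumFin-𝟙 : ∀ {m} (x₀ : Fin m) → sumFin (λ x → 𝟙 (x FinP.≟ x₀)) ≡ 1ℤ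
sumFin-𝟙 x₀ = trans (sumFin-single _ x₀ (λ x x≢x₀ → 𝟙-no (x FinP.≟ x₀) x≢x₀)) (𝟙-yes (x₀ FinP.≟ x₀) refl)

Σ<-𝟙 : ∀ B t₀ → t₀ ≤ B → Σ< (λ t → 𝟙 (t ℕP.≟ t₀)) (suc B) ≡ 1ℤ
Σ<-𝟙 B t₀ t₀≤B =
  trans (Σ<-single _ (suc B) t₀ (s≤s t₀≤B) (λ t t≢t₀ → 𝟙-no (t ℕP.≟ t₀) t≢t₀)) (𝟙-yes (t₀ ℕP.≟ t₀) refl)

allVecs-once : ∀ {m} k (v : Vec (Fin m) k) → sumL (allVecs k) (λ w → 𝟙 (w ≟ᶠ v)) ≡ 1ℤ
allVecs-once zero [] = refl
allVecs-once {m} (suc k) (v₀ ∷ v) = begin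
  sumL (allVecs (suc k)) (λ w → 𝟙 (w ≟ᶠ (v₀ ∷ v)))
    ≡⟨ sumL-concatMap (allFin m) (λ x → List.map (x ∷_) (allVecs k)) _ ⟩
  sumL (allFin m) (λ x → sumL (List.map (x ∷_) (allVecs k)) (λ w → 𝟙 (w ≟ᶠ (v₀ ∷ v))))
    ≡⟨ sumL-cons-indicator FinP._≟_ (allFin m) (λ _ → allVecs k) v₀ v ⟩
  sumL (allFin m) (λ x → 𝟙 (x FinP.≟ v₀) * sumL (allVecs k) (λ w → 𝟙 (w ≟ᶠ v)))
    ≡⟨ sumL-cong (allFin m) (λ x → trans (cong (𝟙 (x FinP.≟ v₀) *_) (allVecs-once k v))
                                         (ℤP.*-identityʳ (𝟙 (x FinP.≟ v₀)))) ⟩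
  sumL (allFin m) (λ x → 𝟙 (x FinP.≟ v₀))
    ≡⟨ trans (sumL-tabulate (λ x → x) (λ x → 𝟙 (x FinP.≟ v₀))) (sumFin-𝟙 v₀) ⟩
  1ℤ ∎
  where open ≡-Reasoning

perms-once : ∀ {n} (π : Perm n) → sumL (perms n) (λ w → 𝟙 (w ≟ᶠ proj₁ π)) ≡ 1ℤ
perms-once {n} (v₀ , isPerm) =
  trans (sumL-filter (allVecs n) isPermᵇ _) (trans (sumL-cong (allVecs n) only-v₀) (allVecs-once n v₀))
  where
  only-v₀ : ∀ w → (if isPermᵇ w then 𝟙 (w ≟ᶠ v₀) else 0ℤ) ≡ 𝟙 (w ≟ᶠ v₀)
  only-v₀ w with w ≟ᶠ v₀
  ... | yes refl rewrite T⇒≡true isPerm = refl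
  ... | no _ with isPermᵇ w
  ...   | true = refl
  ...   | false = refl

box : (k B : ℕ) → List (Vec ℕ k)
box zero B = [] ∷ []
box (suc k) B = concatMap (λ t → List.map (t ∷_) (box k B)) (upTo (suc B))

box-once : ∀ k B (v : Vec ℕ k) → (∀ j → lookup v j ≤ B) → sumL (box k B) (λ w → 𝟙 (w ≟ⁿ v)) ≡ 1ℤ
box-once zero B [] _ = refl
box-once (suc k) B (v₀ ∷ v) bounded = begin
  sumL (box (suc k) B) (λ w → 𝟙 (w ≟ⁿ (v₀ ∷ v)))
    ≡⟨ sumL-concatMap (upTo (suc B)) (λ t → List.map (t ∷_) (box k B)) _ ⟩
  sumL (upTo (suc B)) (λ t → sumL (List.map (t ∷_) (box k B)) (λ w → 𝟙 (w ≟ⁿ (v₀ ∷ v))))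
    ≡⟨ sumL-cons-indicator ℕP._≟_ (upTo (suc B)) (λ _ → box k B) v₀ v ⟩
  sumL (upTo (suc B)) (λ t → 𝟙 (t ℕP.≟ v₀) * sumL (box k B) (λ w → 𝟙 (w ≟ⁿ v)))
    ≡⟨ sumL-cong (upTo (suc B)) (λ t → trans (cong (𝟙 (t ℕP.≟ v₀) *_) (box-once k B v (bounded ∘ fsuc)))
                                             (ℤP.*-identityʳ (𝟙 (t ℕP.≟ v₀)))) ⟩
  sumL (upTo (suc B)) (λ t → 𝟙 (t ℕP.≟ v₀))
    ≡⟨ trans (sumL-applyUpTo (λ t → t) (suc B) (λ t → 𝟙 (t ℕP.≟ v₀))) (Σ<-𝟙 B v₀ (bounded fzero)) ⟩
  1ℤ ∎
  where open ≡-Reasoning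

comps-count : ∀ k m (v : Vec ℕ k) → sumL (comps k m) (λ w → 𝟙 (w ≟ⁿ v)) ≡ 𝟙 (sumℕ (lookup v) ℕP.≟ m)
comps-count zero zero [] = refl
comps-count zero (suc m) [] = refl
comps-count (suc k) m (v₀ ∷ v) = begin
  sumL (comps (suc k) m) (λ w → 𝟙 (w ≟ⁿ (v₀ ∷ v)))
    ≡⟨ sumL-concatMap (upTo (suc m)) (λ i → List.map (i ∷_) (comps k (m ∸ i))) _ ⟩
  sumL (upTo (suc m)) (λ i → sumL (List.map (i ∷_) (comps k (m ∸ i))) (λ w → 𝟙 (w ≟ⁿ (v₀ ∷ v))))
    ≡⟨ sumL-cons-indicator ℕP._≟_ (upTo (suc m)) (λ i → comps k (m ∸ i)) v₀ v ⟩
  sumL (upTo (suc m)) (λ i → 𝟙 (i ℕP.≟ v₀) * sumL (comps k (m ∸ i)) (λ w → 𝟙 (w ≟ⁿ v)))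
    ≡⟨ sumL-cong (upTo (suc m)) (λ i → cong (𝟙 (i ℕP.≟ v₀) *_) (comps-count k (m ∸ i) v)) ⟩
  sumL (upTo (suc m)) (λ i → 𝟙 (i ℕP.≟ v₀) * 𝟙 (|v| ℕP.≟ m ∸ i))
    ≡⟨ sumL-applyUpTo (λ i → i) (suc m) (λ i → 𝟙 (i ℕP.≟ v₀) * 𝟙 (|v| ℕP.≟ m ∸ i)) ⟩
  Σ< (λ i → 𝟙 (i ℕP.≟ v₀) * 𝟙 (|v| ℕP.≟ m ∸ i)) (suc m)
    ≡⟨ head-term ⟩
  𝟙 (v₀ ℕ.+ |v| ℕP.≟ m) ∎
  where
  open ≡-Reasoning
  |v| = sumℕ (lookup v)
  head-term : Σ< (λ i → 𝟙 (i ℕP.≟ v₀) * 𝟙 (|v| ℕP.≟ m ∸ i)) (suc m) ≡ 𝟙 (v₀ ℕ.+ |v| ℕP.≟ m)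
  head-term with v₀ ℕP.≤? m
  ... | yes v₀≤m = trans (Σ<-single _ (suc m) v₀ (s≤s v₀≤m)
                           (λ i i≢v₀ → cong (_* 𝟙 (|v| ℕP.≟ m ∸ i)) (𝟙-no (i ℕP.≟ v₀) i≢v₀)))
                         (trans (cong (_* 𝟙 (|v| ℕP.≟ m ∸ v₀)) (𝟙-yes (v₀ ℕP.≟ v₀) refl))
                         (trans (ℤP.*-identityˡ _) same-test))
    where
    same-test : 𝟙 (|v| ℕP.≟ m ∸ v₀) ≡ 𝟙 (v₀ ℕ.+ |v| ℕP.≟ m)
    same-test = 𝟙-⇔ (|v| ℕP.≟ m ∸ v₀) (v₀ ℕ.+ |v| ℕP.≟ m)
      (λ e → trans (cong (v₀ ℕ.+_) e) (ℕP.m+[n∸m]≡n v₀≤m))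
      (λ e → trans (sym (ℕP.m+n∸m≡n v₀ |v|)) (cong (_∸ v₀) e))
  ... | no v₀≰m = trans (Σ<-zero (suc m) (λ i i≤m → cong (_* 𝟙 (|v| ℕP.≟ m ∸ i))
                                    (𝟙-no (i ℕP.≟ v₀) (λ e → v₀≰m (subst (_≤ m) e (ℕP.≤-pred i≤m))))))
                        (sym (𝟙-no (v₀ ℕ.+ |v| ℕP.≟ m) (λ e → v₀≰m (subst (v₀ ≤_) e (ℕP.m≤m+n v₀ |v|)))))

∈-allVecs : ∀ {m} k (v : Vec (Fin m) k) → v ∈ allVecs k
∈-allVecs zero [] = here refl
∈-allVecs {m} (suc k) (x ∷ v) =
  ∈P.∈-concatMap⁺ (λ y → List.map (y ∷_) (allVecs k)) (lose (∈P.∈-allFin x) (∈P.∈-map⁺ (x ∷_) (∈-allVecs k v)))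

perm∈perms : ∀ {n} (π : Perm n) → proj₁ π ∈ perms n
perm∈perms {n} (v , isPerm) = ∈P.∈-filter⁺ (T? ∘ isPermᵇ) (∈-allVecs n v) isPerm

∈perms⇒isPerm : ∀ {n} {v : Vec (Fin n) n} → v ∈ perms n → T (isPermᵇ v)
∈perms⇒isPerm {n} v∈ = proj₂ (∈P.∈-filter⁻ (T? ∘ isPermᵇ) {xs = allVecs n} v∈)

∈comps⇒sum : ∀ k m (v : Vec ℕ k) → v ∈ comps k m → sumℕ (lookup v) ≡ m
∈comps⇒sum zero zero [] _ = refl
∈comps⇒sum (suc k) m v v∈ with find (∈P.∈-concatMap⁻ (λ i → List.map (i ∷_) (comps k (m ∸ i))) {xs = upTo (suc m)} v∈)
... | i , i∈ , v∈′ with ∈P.∈-map⁻ (i ∷_) v∈′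
... | w , w∈ , refl = trans (cong (i ℕ.+_) (∈comps⇒sum k (m ∸ i) w w∈)) (ℕP.m+[n∸m]≡n (ℕP.≤-pred (∈P.∈-upTo⁻ i∈)))

inLᵇ⇒InL : ∀ {n} (a : Fin n → ℤ) (λv : Vec ℕ n) → T (inLᵇ a λv) → InL a λv
inLᵇ⇒InL {n} a λv h π = toWitness (All.lookup (AllP.all⁺ _ (perms n) h) (perm∈perms π))

InL⇒inLᵇ : ∀ {n} (a : Fin n → ℤ) (λv : Vec ℕ n) → InL a λv → T (inLᵇ a λv)
InL⇒inLᵇ {n} a λv h = AllP.all⁻ _ (All.tabulate (λ {v} v∈ → fromWitness (h (v , ∈perms⇒isPerm v∈))))

solutions : ∀ k (C : Fin k → ℕ) → (∀ j → 1 ≤ C j) → ∀ B w₀ m → m ≤ B →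
  sumL (box k B) (λ x → 𝟙 (w₀ ℕ.+ sumℕ (λ j → lookup x j ℕ.* C j) ℕP.≟ m))
    ≡ (if w₀ ≤ᵇ m then geometrics (List.tabulate C) (m ∸ w₀) else 0ℤ)
solutions zero C pos B w₀ m m≤B =
  trans (ℤP.+-identityʳ _) (trans (cong (λ s → 𝟙 (s ℕP.≟ m)) (ℕP.+-identityʳ w₀)) base)
  where
  base : 𝟙 (w₀ ℕP.≟ m) ≡ (if w₀ ≤ᵇ m then oneS (m ∸ w₀) else 0ℤ)
  base with w₀ ℕP.≤? m
  ... | yes w₀≤m rewrite ≤ᵇ-true w₀≤m | monoS-δ (m ∸ w₀) 0 =
    𝟙-⇔ (w₀ ℕP.≟ m) (m ∸ w₀ ℕP.≟ 0) (λ e → trans (cong (m ∸_) e) (ℕP.n∸n≡0 m))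
                                   (λ e → ℕP.≤-antisym w₀≤m (ℕP.m∸n≡0⇒m≤n e))
  ... | no w₀≰m rewrite ≤ᵇ-false w₀≰m = 𝟙-no (w₀ ℕP.≟ m) (λ e → w₀≰m (ℕP.≤-reflexive e))
solutions (suc k) C pos B w₀ m m≤B = begin
  sumL (box (suc k) B) count-at
    ≡⟨ sumL-concatMap (upTo (suc B)) (λ t → List.map (t ∷_) (box k B)) count-at ⟩
  sumL (upTo (suc B)) (λ t → sumL (List.map (t ∷_) (box k B)) count-at)
    ≡⟨ sumL-cong (upTo (suc B)) (λ t → trans (sumL-map (box k B) (t ∷_) count-at)
         (trans (sumL-cong (box k B) (λ x → cong (λ s → 𝟙 (s ℕP.≟ m)) (sym (ℕP.+-assoc w₀ (t ℕ.* c) _))))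
                (solutions k (C ∘ fsuc) (pos ∘ fsuc) B (w₀ ℕ.+ t ℕ.* c) m m≤B))) ⟩
  sumL (upTo (suc B)) g
    ≡⟨ sumL-applyUpTo (λ t → t) (suc B) g ⟩
  Σ< g (suc B)
    ≡⟨ first-factor ⟩
  (if w₀ ≤ᵇ m then geometric c P′ (m ∸ w₀) else 0ℤ) ∎
  where
  open ≡-Reasoning
  count-at : Vec ℕ (suc k) → ℤ
  count-at x = 𝟙 (w₀ ℕ.+ sumℕ (λ j → lookup x j ℕ.* C j) ℕP.≟ m)
  c = C fzero
  P′ = geometrics (List.tabulate (C ∘ fsuc))
  g : ℕ → ℤ
  g t = if w₀ ℕ.+ t ℕ.* c ≤ᵇ m then P′ (m ∸ (w₀ ℕ.+ t ℕ.* c)) else 0ℤ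
  first-factor : Σ< g (suc B) ≡ (if w₀ ≤ᵇ m then geometric c P′ (m ∸ w₀) else 0ℤ)
  first-factor with w₀ ℕP.≤? m
  ... | yes w₀≤m rewrite ≤ᵇ-true w₀≤m =
    trans (Σ<-cong (suc B) (λ t _ → shifted t))
          (Σ<-extend h (suc r) (suc B) (s≤s (ℕP.≤-trans (ℕP.m∸n≤m m w₀) m≤B))
             (λ t r<t → cong (λ b → if b then P′ (r ∸ t ℕ.* c) else 0ℤ) (multiple-exceeds c r t (pos fzero) r<t)))
    where
    r = m ∸ w₀
    h : ℕ → ℤ
    h t = if t ℕ.* c ≤ᵇ r then P′ (r ∸ t ℕ.* c) else 0ℤ
    shifted : ∀ t → g t ≡ h t
    shifted t rewrite ≤ᵇ-shift w₀ (t ℕ.* c) m w₀≤m | ℕP.∸-+-assoc m w₀ (t ℕ.* c) = refl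
  ... | no w₀≰m rewrite ≤ᵇ-false w₀≰m = Σ<-zero (suc B) (λ t _ → vanishes t)
    where
    vanishes : ∀ t → g t ≡ 0ℤ
    vanishes t rewrite ≤ᵇ-false {w₀ ℕ.+ t ℕ.* c} {m} (λ le → w₀≰m (ℕP.≤-trans (ℕP.m≤m+n w₀ _) le)) = refl

sumL-⊛ : ∀ {A : Set} (xs : List A) (S : A → Series) g m →
  ((λ m′ → sumL xs (λ x → S x m′)) ⊛ g) m ≡ sumL xs (λ x → (S x ⊛ g) m)
sumL-⊛ [] S g m = ⊛-zeroˡ (λ _ → 0ℤ) g (λ _ → refl) m
sumL-⊛ (x ∷ xs) S g m = trans (⊛-distribʳ-+ (S x) (λ m′ → sumL xs (λ y → S y m′)) g m)
                              (cong (λ s → (S x ⊛ g) m + s) (sumL-⊛ xs S g m))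

tabulate-snoc : ∀ {A : Set} {N} (f : Fin (suc N) → A) → List.tabulate f ≡ List.tabulate (f ∘ inject₁) ∷ʳ f (fromℕ N)
tabulate-snoc {N = zero} f = refl
tabulate-snoc {N = suc N} f = cong (f fzero ∷_) (tabulate-snoc (f ∘ fsuc))

*-nonneg : ∀ {x y} → 0ℤ ℤ.≤ x → 0ℤ ℤ.≤ y → 0ℤ ℤ.≤ x * y
*-nonneg {+ m} {+ k} _ _ = subst (0ℤ ℤ.≤_) (ℤP.pos-* m k) (ℤ.+≤+ z≤n)

*-nonpos : ∀ {x y} → x ℤ.≤ 0ℤ → y ℤ.≤ 0ℤ → 0ℤ ℤ.≤ x * y
*-nonpos {x} {y} x≤0 y≤0 = subst (0ℤ ℤ.≤_) (neg*neg x y) (*-nonneg (ℤP.neg-mono-≤ x≤0) (ℤP.neg-mono-≤ y≤0))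
  where neg*neg : ∀ x y → (- x) * (- y) ≡ x * y
        neg*neg = solve-∀

-- Exchange inequality: if aⱼ ≤ A at positions j ≤ k and aⱼ ≥ A beyond k,
-- then the positions ≤ k carry the least a-weight among all index sets
-- of the same shape τ⁻¹{0..k}, τ injective.
prefix-minimal : ∀ {m} (a : Fin m → ℤ) (k : ℕ) (A : ℤ) →
  (∀ j → toℕ j ≤ k → a j ℤ.≤ A) → (∀ j → k ℕ.< toℕ j → A ℤ.≤ a j) →
  (τ : Fin m → Fin m) → Injective _≡_ _≡_ τ →
  sumFin (λ j → a j * atMost k j) ℤ.≤ sumFin (λ j → a j * atMost k (τ j))
prefix-minimal a k A below above τ τinj = ℤP.0≤i-j⇒j≤i (subst (0ℤ ℤ.≤_) (sym difference) (sumFin-nonneg _ term))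
  where
  E L : Fin _ → ℤ
  E j = atMost k (τ j)
  L j = atMost k j
  -- E and L have the same number of ones
  balanced : sumFin (λ j → E j - L j) ≡ 0ℤ
  balanced = trans (sumFin-- E L) (trans (cong (_- sumFin L) (sumFin-reindex τ τinj L)) (ℤP.+-inverseʳ (sumFin L)))
  split : ∀ x y e f → x * e - x * f ≡ (x - y) * (e - f) + y * (e - f)
  split = solve-∀
  difference : sumFin (λ j → a j * E j) - sumFin (λ j → a j * L j) ≡ sumFin (λ j → (a j - A) * (E j - L j))
  difference = begin
    sumFin (λ j → a j * E j) - sumFin (λ j → a j * L j)
      ≡⟨ sumFin-- (λ j → a j * E j) (λ j → a j * L j) ⟨
    sumFin (λ j → a j * E j - a j * L j)
      ≡⟨ sumFin-cong (λ j → split (a j) A (E j) (L j)) ⟩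
    sumFin (λ j → (a j - A) * (E j - L j) + A * (E j - L j))
      ≡⟨ sumFin-+ (λ j → (a j - A) * (E j - L j)) (λ j → A * (E j - L j)) ⟩
    sumFin (λ j → (a j - A) * (E j - L j)) + sumFin (λ j → A * (E j - L j))
      ≡⟨ cong (λ x → sumFin (λ j → (a j - A) * (E j - L j)) + x)
              (trans (sumFin-*ˡ A (λ j → E j - L j)) (trans (cong (A *_) balanced) (ℤP.*-zeroʳ A))) ⟩
    sumFin (λ j → (a j - A) * (E j - L j)) + 0ℤ
      ≡⟨ ℤP.+-identityʳ _ ⟩
    sumFin (λ j → (a j - A) * (E j - L j)) ∎
    where open ≡-Reasoning
  E≥0 : ∀ j → 0ℤ ℤ.≤ E j
  E≥0 j with k <ᵇ toℕ (τ j)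
  ... | true = ℤP.≤-refl
  ... | false = ℤ.+≤+ z≤n
  E≤1 : ∀ j → E j - 1ℤ ℤ.≤ 0ℤ
  E≤1 j with k <ᵇ toℕ (τ j)
  ... | true = ℤ.-≤+
  ... | false = ℤP.≤-refl
  -- each summand is a product of two factors of the same sign
  term : ∀ j → 0ℤ ℤ.≤ (a j - A) * (E j - L j)
  term j with toℕ j ℕP.≤? k
  ... | yes j≤k rewrite <ᵇ-false (ℕP.≤⇒≯ j≤k) =
    *-nonpos (ℤP.i≤j⇒i-j≤0 (below j j≤k)) (E≤1 j)
  ... | no j≰k rewrite <ᵇ-true (ℕP.≰⇒> j≰k) =
    *-nonneg (ℤP.i≤j⇒0≤j-i (above j (ℕP.≰⇒> j≰k))) (subst (0ℤ ℤ.≤_) (sym (ℤP.+-identityʳ (E j))) (E≥0 j))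

-- Fix n = N + 1 and a : Fin n → ℤ with a₁ + … + aₙ = 1, and
-- write s t = a₁ + … + a_t (positions 0-based).  Unfolding `bcoef`, column t
-- of b is [i ≤ t] − s t for t < last, and the last column is constant 1.

module Matrix (N : ℕ) (a : Fin (suc N) → ℤ) (Σa≡1 : sumFin a ≡ 1ℤ) where

  n : ℕ
  n = suc N

  lastᶠ : Fin n
  lastᶠ = fromℕ N

  s : Fin n → ℤ
  s = psum a

  b-last : ∀ i → bcoef a i lastᶠ ≡ 1ℤ
  b-last i rewrite FinP.toℕ-fromℕ N | ≡ᵇ-true {N} refl = refl

  b-inner : ∀ i t → bcoef a i (inject₁ t) ≡ atMost (toℕ t) i - s (inject₁ t)
  b-inner i t rewrite FinP.toℕ-inject₁ t
    | ≡ᵇ-false {suc (toℕ t)} {n} (λ e → ℕP.<-irrefl (ℕP.suc-injective e) (FinP.toℕ<n t))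
    with toℕ t <ᵇ toℕ i
  ... | true = sym (ℤP.+-identityˡ _)
  ... | false = refl

  psum-inner : ∀ t → s (inject₁ t) ≡ sumFin (λ i → a i * atMost (toℕ t) i)
  psum-inner t = sumFin-cong summand
    where
    summand : ∀ i → (if toℕ i ≤ᵇ toℕ (inject₁ t) then a i else 0ℤ) ≡ a i * atMost (toℕ t) i
    summand i rewrite FinP.toℕ-inject₁ t with toℕ i ℕP.≤? toℕ t
    ... | yes i≤t rewrite ≤ᵇ-true i≤t | <ᵇ-false (ℕP.≤⇒≯ i≤t) = sym (ℤP.*-identityʳ (a i))
    ... | no i≰t rewrite ≤ᵇ-false i≰t | <ᵇ-true (ℕP.≰⇒> i≰t) = sym (ℤP.*-zeroʳ (a i))

  weighted-inner : ∀ t → sumFin (λ i → a i * bcoef a i (inject₁ t)) ≡ 0ℤ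
  weighted-inner t = begin
    sumFin (λ i → a i * bcoef a i (inject₁ t))
      ≡⟨ sumFin-cong (λ i → trans (cong (a i *_) (b-inner i t)) (ℤP.*-distribˡ-+ (a i) (atMost (toℕ t) i) (- s p))) ⟩
    sumFin (λ i → a i * atMost (toℕ t) i + a i * - s p)
      ≡⟨ sumFin-+ (λ i → a i * atMost (toℕ t) i) (λ i → a i * - s p) ⟩
    sumFin (λ i → a i * atMost (toℕ t) i) + sumFin (λ i → a i * - s p)
      ≡⟨ cong₂ _+_ (sym (psum-inner t)) (sumFin-*ʳ (- s p) a) ⟩
    s p + sumFin a * - s p
      ≡⟨ cong (λ x → s p + x * - s p) Σa≡1 ⟩
    s p + 1ℤ * - s p
      ≡⟨ cong (λ x → s p + x) (ℤP.*-identityˡ (- s p)) ⟩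
    s p - s p
      ≡⟨ ℤP.+-inverseʳ (s p) ⟩
    0ℤ ∎
    where
    open ≡-Reasoning
    p = inject₁ t

  weighted-last : sumFin (λ i → a i * bcoef a i lastᶠ) ≡ 1ℤ
  weighted-last = trans (sumFin-cong (λ i → trans (cong (a i *_) (b-last i)) (ℤP.*-identityʳ (a i)))) Σa≡1

  row-step : ∀ t j → bcoef a (inject₁ t) j - bcoef a (fsuc t) j ≡ select (inject₁ t) j 1ℤ
  row-step t j with lastView j
  ... | last rewrite b-last (inject₁ t) | b-last (fsuc t) =
    sym (select-≢ {x = inject₁ t} {y = lastᶠ} 1ℤ (λ e → FinP.fromℕ≢inject₁ (sym e)))
  ... | inner u rewrite b-inner (inject₁ t) u | b-inner (fsuc t) u =
    trans (cancel (atMost (toℕ u) (inject₁ t)) _ (s (inject₁ u))) indicator-step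
    where
    cancel : ∀ x y z → (x - z) - (y - z) ≡ x - y
    cancel = solve-∀
    step : ∀ p q → (if p <ᵇ q then 0ℤ else 1ℤ) - (if p <ᵇ suc q then 0ℤ else 1ℤ) ≡ (if q ≡ᵇ p then 1ℤ else 0ℤ)
    step p q with ℕP.<-cmp p q
    ... | tri< p<q _ _ rewrite <ᵇ-true p<q | <ᵇ-true (ℕP.m<n⇒m<1+n p<q)
                             | ≡ᵇ-false {q} {p} (λ e → ℕP.<-irrefl (sym e) p<q) = refl
    ... | tri≈ _ refl _ rewrite <ᵇ-false {p} {p} (ℕP.<-irrefl refl) | <ᵇ-true (ℕP.n<1+n p)
                              | ≡ᵇ-true {p} refl = refl
    ... | tri> _ _ q<p rewrite <ᵇ-false {p} {q} (ℕP.<⇒≯ q<p) | <ᵇ-false {p} {suc q} (λ h → ℕP.<⇒≱ q<p (ℕ.s≤s⁻¹ h))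
                             | ≡ᵇ-false {q} {p} (λ e → ℕP.<-irrefl e q<p) = refl
    indicator-step : atMost (toℕ u) (inject₁ t) - atMost (toℕ u) (fsuc t) ≡ select (inject₁ t) (inject₁ u) 1ℤ
    indicator-step rewrite FinP.toℕ-inject₁ t | FinP.toℕ-inject₁ u = step (toℕ u) (toℕ t)

  colSum : Fin n → ℤ
  colSum j = sumFin (λ i → bcoef a i j)

  colSum-last : colSum lastᶠ ≡ + n
  colSum-last = trans (sumFin-cong b-last) (trans (sumFin-const {n} 1ℤ) (ℤP.*-identityʳ _))

  colSum-inner : ∀ t → colSum (inject₁ t) ≡ cexp a (inject₁ t)
  colSum-inner t = begin
    colSum (inject₁ t)
      ≡⟨ sumFin-cong {g = λ i → atMost (toℕ t) i - s (inject₁ t)} (λ i → b-inner i t) ⟩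
    sumFin {n} (λ i → atMost (toℕ t) i - s (inject₁ t))
      ≡⟨ sumFin-- {n} (λ i → atMost (toℕ t) i) (λ _ → s (inject₁ t)) ⟩
    sumFin {n} (λ i → atMost (toℕ t) i) - sumFin {n} (λ _ → s (inject₁ t))
      ≡⟨ cong₂ _-_ (count-atMost {n} (toℕ t) (ℕP.m<n⇒m<1+n (FinP.toℕ<n t))) (sumFin-const {n} (s (inject₁ t))) ⟩
    + suc (toℕ t) - + n * s (inject₁ t)
      ≡⟨ cong (λ x → + suc x - + n * s (inject₁ t)) (sym (FinP.toℕ-inject₁ t)) ⟩
    cexp a (inject₁ t) ∎
    where open ≡-Reasoning

  -- The linear map c ↦ μ c, (μ c)ᵢ = Σⱼ cⱼ b_{i,j}.  If the π-term of the
  -- theorem contributes z^λ with exponent vector c = k + d_π, then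
  -- λ_{π(i)} = (μ c)ᵢ; the next lemmas invert μ.
  μ : (Fin n → ℤ) → Fin n → ℤ
  μ c i = sumFin (λ j → c j * bcoef a i j)

  μ-step : ∀ c t → μ c (inject₁ t) - μ c (fsuc t) ≡ c (inject₁ t)
  μ-step c t = begin
    μ c (inject₁ t) - μ c (fsuc t)
      ≡⟨ sumFin-- (λ j → c j * bcoef a (inject₁ t) j) (λ j → c j * bcoef a (fsuc t) j) ⟨
    sumFin (λ j → c j * bcoef a (inject₁ t) j - c j * bcoef a (fsuc t) j)
      ≡⟨ sumFin-cong (λ j → trans (sym (distrib (c j) (bcoef a (inject₁ t) j) (bcoef a (fsuc t) j))) (cong (c j *_) (row-step t j))) ⟩
    sumFin (λ j → c j * select (inject₁ t) j 1ℤ)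
      ≡⟨ sumFin-cong (λ j → scale (toℕ (inject₁ t) ≡ᵇ toℕ j) (c j)) ⟩
    sumFin (λ j → select (inject₁ t) j (c j))
      ≡⟨ sumFin-select (inject₁ t) c ⟩
    c (inject₁ t) ∎
    where
    open ≡-Reasoning
    distrib : ∀ x y z → x * (y - z) ≡ x * y - x * z
    distrib = solve-∀
    scale : ∀ b x → x * (if b then 1ℤ else 0ℤ) ≡ (if b then x else 0ℤ)
    scale true x = ℤP.*-identityʳ x
    scale false x = ℤP.*-zeroʳ x

  μ-weighted : ∀ c → sumFin (λ i → a i * μ c i) ≡ c lastᶠ
  μ-weighted c = begin
    sumFin (λ i → a i * μ c i)
      ≡⟨ sumFin-cong (λ i → sym (sumFin-*ˡ (a i) (λ j → c j * bcoef a i j))) ⟩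
    sumFin (λ i → sumFin (λ j → a i * (c j * bcoef a i j)))
      ≡⟨ sumFin-swap (λ i j → a i * (c j * bcoef a i j)) ⟩
    sumFin (λ j → sumFin (λ i → a i * (c j * bcoef a i j)))
      ≡⟨ sumFin-cong (λ j → trans (sumFin-cong (λ i → swap (a i) (c j) (bcoef a i j))) (sumFin-*ˡ (c j) (λ i → a i * bcoef a i j))) ⟩
    sumFin (λ j → c j * W j)
      ≡⟨ sumFin-last (λ j → c j * W j) ⟩
    sumFin (λ t → c (inject₁ t) * W (inject₁ t)) + c lastᶠ * W lastᶠ
      ≡⟨ cong₂ _+_ (trans (sumFin-cong (λ t → trans (cong (c (inject₁ t) *_) (weighted-inner t))
                                                     (ℤP.*-zeroʳ (c (inject₁ t)))))
                          (sumFin-0 {N}))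
                   (trans (cong (c lastᶠ *_) weighted-last) (ℤP.*-identityʳ (c lastᶠ))) ⟩
    0ℤ + c lastᶠ
      ≡⟨ ℤP.+-identityˡ (c lastᶠ) ⟩
    c lastᶠ ∎
    where
    open ≡-Reasoning
    W : Fin n → ℤ
    W j = sumFin (λ i → a i * bcoef a i j)
    swap : ∀ x y z → x * (y * z) ≡ y * (x * z)
    swap = solve-∀

  μ-injective : ∀ c c′ → (∀ i → μ c i ≡ μ c′ i) → ∀ j → c j ≡ c′ j
  μ-injective c c′ eq j with lastView j
  ... | last = trans (sym (μ-weighted c)) (trans (sumFin-cong (λ i → cong (a i *_) (eq i))) (μ-weighted c′))
  ... | inner t = trans (sym (μ-step c t)) (trans (cong₂ _-_ (eq (inject₁ t)) (eq (fsuc t))) (μ-step c′ t))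

  μ-solve : ∀ (ν c : Fin n → ℤ) → (∀ t → c (inject₁ t) ≡ ν (inject₁ t) - ν (fsuc t)) →
    c lastᶠ ≡ sumFin (λ i → a i * ν i) → ∀ i → μ c i ≡ ν i
  μ-solve ν c steps weighted i = ℤP.i-j≡0⇒i≡j (μ c i) (ν i) (trans (chain-constant δ δ-step i) δ₀≡0)
    where
    δ : Fin n → ℤ
    δ i = μ c i - ν i
    rearrange : ∀ x y z w → (x - y) - (z - w) ≡ 0ℤ → x - z ≡ y - w
    rearrange x y z w e = trans (sym (lemma x y z w)) (trans (cong (_+ (y - w)) e) (ℤP.+-identityˡ _))
      where lemma : ∀ x y z w → (x - y) - (z - w) + (y - w) ≡ x - z
            lemma = solve-∀
    δ-step : ∀ t → δ (inject₁ t) ≡ δ (fsuc t)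
    δ-step t = rearrange (μ c (inject₁ t)) (μ c (fsuc t)) (ν (inject₁ t)) (ν (fsuc t))
                 (trans (cong₂ _-_ (μ-step c t) (sym (steps t))) (ℤP.+-inverseʳ (c (inject₁ t))))
    distrib : ∀ x y z → x * (y - z) ≡ x * y - x * z
    distrib = solve-∀
    δ₀≡0 : δ fzero ≡ 0ℤ
    δ₀≡0 = begin
      δ fzero                                 ≡⟨ ℤP.*-identityˡ _ ⟨
      1ℤ * δ fzero                            ≡⟨ cong (_* δ fzero) Σa≡1 ⟨
      sumFin a * δ fzero                      ≡⟨ sumFin-*ʳ (δ fzero) a ⟨
      sumFin (λ i → a i * δ fzero)            ≡⟨ sumFin-cong (λ i → cong (a i *_) (chain-constant δ δ-step i)) ⟨
      sumFin (λ i → a i * δ i)                ≡⟨ sumFin-cong (λ i → distrib (a i) (μ c i) (ν i)) ⟩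
      sumFin (λ i → a i * μ c i - a i * ν i)  ≡⟨ sumFin-- (λ i → a i * μ c i) (λ i → a i * ν i) ⟩
      sumFin (λ i → a i * μ c i) - sumFin (λ i → a i * ν i)
                                              ≡⟨ cong₂ _-_ (μ-weighted c) (sym weighted) ⟩
      c lastᶠ - c lastᶠ                       ≡⟨ ℤP.+-inverseʳ (c lastᶠ) ⟩
      0ℤ                                      ∎
      where open ≡-Reasoning

  sumFin-μ : ∀ c → sumFin (μ c) ≡ sumFin (λ j → c j * colSum j)
  sumFin-μ c = trans (sumFin-swap (λ i j → c j * bcoef a i j))
                     (sumFin-cong (λ j → sumFin-*ˡ (c j) (λ i → bcoef a i j)))

  -- The exponent of z_u in ∏ⱼ m_j^{c_j}, where m_j is the j-th monomial
  -- z_{π(1)}^{b_{1,j}} ⋯ z_{π(n)}^{b_{n,j}} of the π-term.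
  exponent : Perm n → (Fin n → ℤ) → Fin n → ℤ
  exponent π c u = sumFin (λ j → c j * monoExp a π j u)

  monoExp-at : ∀ π j i → monoExp a π j (app π i) ≡ bcoef a i j
  monoExp-at π j i = sumFin-select-injective (app π) (perm-injective π) i (λ i′ → bcoef a i′ j)

  exponent-at : ∀ π c i → exponent π c (app π i) ≡ μ c i
  exponent-at π c i = sumFin-cong (λ j → cong (c j *_) (monoExp-at π j i))

  -- The exponent vector k + d_π of the term indexed by k, d_π the indicator of
  -- the descent set; `Rep a π k λv` says λv = exponent π (shift π k).
  shift : Perm n → Vec ℕ n → Fin n → ℤ
  shift π k j = + (lookup k j ℕ.+ dind (proj₁ π) j)

  Rep⇒μ : ∀ π k λv → Rep a π k λv → ∀ i → + lookup λv (app π i) ≡ μ (shift π k) i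
  Rep⇒μ π k λv rep i = trans (rep (app π i)) (exponent-at π (shift π k) i)

  μ⇒Rep : ∀ π k λv → (∀ i → + lookup λv (app π i) ≡ μ (shift π k) i) → Rep a π k λv
  μ⇒Rep π k λv h u = subst (λ w → + lookup λv w ≡ exponent π (shift π k) w) (inv-r (app π) πinj u)
    (trans (h (inv (app π) πinj u)) (sym (exponent-at π (shift π k) (inv (app π) πinj u))))
    where πinj = perm-injective π

-- Then the proper prefix sums of a are
-- ≤ 0, so b ≥ 0, every column sum of b is ≥ 1, and the a-weighted
-- column sums of b read in any order are ≥ 0.  The last fact shows that
-- every z^λ occurring on the right-hand side of the theorem has λ ∈ L.

module Positivity (N : ℕ) (a : Fin (suc N) → ℤ) (Σa≡1 : sumFin a ≡ 1ℤ) (sorted : Sorted a) where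

  open Matrix N a Σa≡1

  sorted-below : ∀ t i → toℕ i ≤ toℕ t → a i ℤ.≤ a (inject₁ t)
  sorted-below t i i≤t = sorted i (inject₁ t) (subst (toℕ i ≤_) (sym (FinP.toℕ-inject₁ t)) i≤t)

  sorted-above : ∀ t i → toℕ t ℕ.< toℕ i → a (inject₁ t) ℤ.≤ a i
  sorted-above t i t<i = sorted (inject₁ t) i (subst (ℕ._≤ toℕ i) (sym (FinP.toℕ-inject₁ t)) (ℕP.<⇒≤ t<i))

  -- The proper prefix sums of a are ≤ 0: if aₜ ≤ 0 then so are a₁ … aₜ;
  -- otherwise every later aᵢ is ≥ 1, and sₜ ≥ 1 would force Σa ≥ 2.
  psum-nonpos : ∀ t → s (inject₁ t) ℤ.≤ 0ℤ
  psum-nonpos t with a (inject₁ t) ℤP.≤? 0ℤ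
  ... | yes aₜ≤0 = subst (ℤ._≤ 0ℤ) (sym (psum-inner t)) (sumFin-nonpos _ prefix≤0)
    where
    prefix≤0 : ∀ i → a i * atMost (toℕ t) i ℤ.≤ 0ℤ
    prefix≤0 i with toℕ i ℕP.≤? toℕ t
    ... | yes i≤t rewrite <ᵇ-false (ℕP.≤⇒≯ i≤t) =
      subst (ℤ._≤ 0ℤ) (sym (ℤP.*-identityʳ (a i))) (ℤP.≤-trans (sorted-below t i i≤t) aₜ≤0)
    ... | no i≰t rewrite <ᵇ-true (ℕP.≰⇒> i≰t) = ℤP.≤-reflexive (ℤP.*-zeroʳ (a i))
  ... | no aₜ≰0 with s (inject₁ t) ℤP.≤? 0ℤ
  ...   | yes sₜ≤0 = sₜ≤0
  ...   | no sₜ≰0 = ⊥-elim (ℤP.<-irrefl (sym Σa≡1) (ℤP.<-≤-trans (ℤ.+<+ (s≤s (s≤s z≤n))) Σa≥2))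
    where
    beyond : ∀ i → toℕ t ℕ.< toℕ i → 1ℤ ℤ.≤ a i
    beyond i t<i = ℤP.≤-trans (ℤP.i<j⇒suc[i]≤j (ℤP.≰⇒> aₜ≰0)) (sorted-above t i t<i)
    rest : Fin (suc N) → ℤ
    rest i = a i * (1ℤ - atMost (toℕ t) i)
    rest≥0 : ∀ i → 0ℤ ℤ.≤ rest i
    rest≥0 i with toℕ i ℕP.≤? toℕ t
    ... | yes i≤t rewrite <ᵇ-false (ℕP.≤⇒≯ i≤t) = ℤP.≤-reflexive (sym (ℤP.*-zeroʳ (a i)))
    ... | no i≰t rewrite <ᵇ-true (ℕP.≰⇒> i≰t) =
      subst (0ℤ ℤ.≤_) (sym (ℤP.*-identityʳ (a i))) (ℤP.≤-trans (ℤ.+≤+ z≤n) (beyond i (ℕP.≰⇒> i≰t)))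
    rest-next : rest (fsuc t) ≡ a (fsuc t)
    rest-next rewrite <ᵇ-true (ℕP.n<1+n (toℕ t)) = ℤP.*-identityʳ (a (fsuc t))
    split : ∀ x e → x ≡ x * e + x * (1ℤ - e)
    split = solve-∀
    Σa≥2 : + 2 ℤ.≤ sumFin a
    Σa≥2 = subst (+ 2 ℤ.≤_)
      (sym (trans (sumFin-cong (λ i → split (a i) (atMost (toℕ t) i)))
             (trans (sumFin-+ (λ i → a i * atMost (toℕ t) i) rest) (cong (_+ sumFin rest) (sym (psum-inner t))))))
      (ℤP.+-mono-≤ (ℤP.i<j⇒suc[i]≤j (ℤP.≰⇒> sₜ≰0))
                   (ℤP.≤-trans (beyond (fsuc t) (ℕP.n<1+n (toℕ t)))
                               (subst (ℤ._≤ sumFin rest) rest-next (sumFin-term rest rest≥0 (fsuc t)))))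

  b-nonneg : ∀ i j → 0ℤ ℤ.≤ bcoef a i j
  b-nonneg i j with lastView j
  ... | last = subst (0ℤ ℤ.≤_) (sym (b-last i)) (ℤ.+≤+ z≤n)
  ... | inner t = subst (0ℤ ℤ.≤_) (sym (b-inner i t))
    (ℤP.i≤j⇒0≤j-i (ℤP.≤-trans (psum-nonpos t) (indicator≥0 (toℕ t <ᵇ toℕ i))))
    where indicator≥0 : ∀ b → 0ℤ ℤ.≤ (if b then 0ℤ else 1ℤ)
          indicator≥0 true = ℤP.≤-refl
          indicator≥0 false = ℤ.+≤+ z≤n

  colSum-pos : ∀ j → 1ℤ ℤ.≤ colSum j
  colSum-pos j with lastView j
  ... | last = subst (1ℤ ℤ.≤_) (sym colSum-last) (ℤ.+≤+ (s≤s z≤n))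
  ... | inner t = subst (1ℤ ℤ.≤_) (sym (trans (colSum-inner t) (rewrite-cexp (+ suc (toℕ (inject₁ t))) (+ n) (s (inject₁ t)))))
    (ℤP.≤-trans (ℤ.+≤+ (s≤s z≤n))
      (ℤP.≤-trans (ℤP.≤-reflexive (sym (ℤP.+-identityʳ _)))
        (ℤP.+-monoʳ-≤ (+ suc (toℕ (inject₁ t)))
          (*-nonneg {+ n} { - s (inject₁ t)} (ℤ.+≤+ z≤n) (ℤP.neg-mono-≤ (psum-nonpos t))))))
    where rewrite-cexp : ∀ x y z → x - y * z ≡ x + y * (- z)
          rewrite-cexp = solve-∀

  weighted-column-nonneg : (τ : Fin n → Fin n) → Injective _≡_ _≡_ τ →
    ∀ l → 0ℤ ℤ.≤ sumFin (λ j → a j * bcoef a (τ j) l)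
  weighted-column-nonneg τ τinj l with lastView l
  ... | last = subst (0ℤ ℤ.≤_) (sym (trans (sumFin-cong (λ j → trans (cong (a j *_) (b-last (τ j))) (ℤP.*-identityʳ (a j)))) Σa≡1))
                     (ℤ.+≤+ z≤n)
  ... | inner t = subst (0ℤ ℤ.≤_) (sym expand)
    (ℤP.i≤j⇒0≤j-i (subst (ℤ._≤ sumFin (λ j → a j * atMost (toℕ t) (τ j))) (sym (psum-inner t))
      (prefix-minimal a (toℕ t) (a (inject₁ t)) (sorted-below t) (sorted-above t) τ τinj)))
    where
    distrib : ∀ x e s → x * (e - s) ≡ x * e - x * s
    distrib = solve-∀
    sₜ = s (inject₁ t)
    expand : sumFin (λ j → a j * bcoef a (τ j) (inject₁ t)) ≡ sumFin (λ j → a j * atMost (toℕ t) (τ j)) - sₜ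
    expand = begin
      sumFin (λ j → a j * bcoef a (τ j) (inject₁ t))
        ≡⟨ sumFin-cong (λ j → trans (cong (a j *_) (b-inner (τ j) t)) (distrib (a j) (atMost (toℕ t) (τ j)) sₜ)) ⟩
      sumFin (λ j → a j * atMost (toℕ t) (τ j) - a j * sₜ)
        ≡⟨ sumFin-- (λ j → a j * atMost (toℕ t) (τ j)) (λ j → a j * sₜ) ⟩
      sumFin (λ j → a j * atMost (toℕ t) (τ j)) - sumFin (λ j → a j * sₜ)
        ≡⟨ cong (λ x → sumFin (λ j → a j * atMost (toℕ t) (τ j)) - x)
                (trans (sumFin-*ʳ sₜ a) (trans (cong (_* sₜ) Σa≡1) (ℤP.*-identityˡ sₜ))) ⟩
      sumFin (λ j → a j * atMost (toℕ t) (τ j)) - sₜ ∎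
      where open ≡-Reasoning

  -- Every z^λ occurring in the π-term has λ ∈ L: Σⱼ aⱼ λ_{σ(j)} = Σₗ cₗ · Σⱼ
  -- aⱼ b_{τ(j),l} with τ = π⁻¹σ and c = k + d_π ≥ 0.
  Rep⇒InL : ∀ π k λv → Rep a π k λv → InL a λv
  Rep⇒InL π k λv rep σ = subst (0ℤ ℤ.≤_) (sym regroup)
    (sumFin-nonneg _ (λ l → *-nonneg {c l} (ℤ.+≤+ z≤n) (weighted-column-nonneg τ τinj l)))
    where
    πinj = perm-injective π
    τ : Fin n → Fin n
    τ j = inv (app π) πinj (app σ j)
    τinj : Injective _≡_ _≡_ τ
    τinj e = perm-injective σ (trans (sym (inv-r (app π) πinj _)) (trans (cong (app π) e) (inv-r (app π) πinj _)))
    c = shift π k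
    value : ∀ j → + lookup λv (app σ j) ≡ μ c (τ j)
    value j = trans (cong (λ u → + lookup λv u) (sym (inv-r (app π) πinj (app σ j)))) (Rep⇒μ π k λv rep (τ j))
    swap : ∀ x y z → x * (y * z) ≡ y * (x * z)
    swap = solve-∀
    regroup : sumFin (λ j → a j * + lookup λv (app σ j)) ≡ sumFin (λ l → c l * sumFin (λ j → a j * bcoef a (τ j) l))
    regroup = begin
      sumFin (λ j → a j * + lookup λv (app σ j))
        ≡⟨ sumFin-cong (λ j → trans (cong (a j *_) (value j)) (sym (sumFin-*ˡ (a j) (λ l → c l * bcoef a (τ j) l)))) ⟩
      sumFin (λ j → sumFin (λ l → a j * (c l * bcoef a (τ j) l)))
        ≡⟨ sumFin-swap (λ j l → a j * (c l * bcoef a (τ j) l)) ⟩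
      sumFin (λ l → sumFin (λ j → a j * (c l * bcoef a (τ j) l)))
        ≡⟨ sumFin-cong (λ l → trans (sumFin-cong (λ j → swap (a j) (c l) (bcoef a (τ j) l)))
                                    (sumFin-*ˡ (c l) (λ j → a j * bcoef a (τ j) l))) ⟩
      sumFin (λ l → c l * sumFin (λ j → a j * bcoef a (τ j) l)) ∎
      where open ≡-Reasoning

-- A
-- representation (π, k) of λ reads λ along π with gaps λ_{π(t)} − λ_{π(t+1)} =
-- k_t + [t ∈ D_π] ≥ 0, and a zero gap forces π(t) < π(t+1): π lists the
-- positions by decreasing λ, ties by position. So π is the sorting permutation
-- of λ and, μ being injective, k is determined.  Conversely, for λ ∈ L the
-- gaps of the sorted sequence and its a-weighted sum (≥ 0 by λ ∈ L) dominate
-- the descent indicator.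

minus-split : ∀ x y z → + x - + y ≡ + z → x ≡ z ℕ.+ y
minus-split x y z e = ℤP.+-injective (trans (sym (cancel (+ x) (+ y))) (cong (_+ + y) e))
  where cancel : ∀ X Y → (X - Y) + Y ≡ X
        cancel = solve-∀

minus-∸ : ∀ {x y} → y ≤ x → + x - + y ≡ + (x ∸ y)
minus-∸ {x} {y} y≤x = trans (ℤP.m-n≡m⊖n x y) (ℤP.⊖-≥ y≤x)

module Bijection (N : ℕ) (a : Fin (suc N) → ℤ) (Σa≡1 : sumFin a ≡ 1ℤ) (sorted : Sorted a) (λv : Vec ℕ (suc N)) where

  open Matrix N a Σa≡1
  open Positivity N a Σa≡1 sorted
  open Sorting (lookup λv)

  Rep⇒increasing : ∀ π k → Rep a π k λv → Increasing π
  Rep⇒increasing π k rep t = by-gap (kₜ ℕ.+ dₜ) refl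
    where
    x = app π (inject₁ t)
    y = app π (fsuc t)
    kₜ = lookup k (inject₁ t)
    dₜ = dind (proj₁ π) (inject₁ t)
    λ-gap : lookup λv x ≡ (kₜ ℕ.+ dₜ) ℕ.+ lookup λv y
    λ-gap = minus-split (lookup λv x) (lookup λv y) (kₜ ℕ.+ dₜ)
      (trans (cong₂ _-_ (Rep⇒μ π k λv rep (inject₁ t)) (Rep⇒μ π k λv rep (fsuc t))) (μ-step (shift π k) t))
    true≢false : true ≢ false
    true≢false ()
    no-descent : dₜ ≡ 0 → descent (proj₁ π) t ≡ false
    no-descent d≡0 with descent (proj₁ π) t in d
    ... | false = refl
    ... | true = ⊥-elim (ℕP.1+n≢0 (subst (λ b → (if b then 1 else 0) ≡ 0) d (trans (sym (dind-inner (proj₁ π) t)) d≡0)))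
    by-gap : ∀ g → kₜ ℕ.+ dₜ ≡ g → x ≺ y
    by-gap (suc m) e = inj₁ (subst (lookup λv y ℕ.<_) (sym (trans λ-gap (cong (ℕ._+ lookup λv y) e)))
                                   (ℕP.m<n+m (lookup λv y) (s≤s z≤n)))
    by-gap zero e = inj₂ (trans λ-gap (cong (ℕ._+ lookup λv y) e) , ascending)
      where
      ascending : toℕ x ℕ.< toℕ y
      ascending = ℕP.≤∧≢⇒< (ℕP.≮⇒≥ (λ lt → true≢false (trans (sym (<ᵇ-true lt)) (no-descent (ℕP.m+n≡0⇒n≡0 kₜ e)))))
                           (inject₁≢suc t ∘ perm-injective π ∘ FinP.toℕ-injective)

  -- Hence π is determined, and then so is k since μ is injective.
  Rep-unique : ∀ π k π′ k′ → Rep a π k λv → Rep a π′ k′ λv → (proj₁ π ≡ proj₁ π′) × (k ≡ k′)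
  Rep-unique π k π′ k′ rep rep′ = same-π , vec-ext k k′ same-k
    where
    same-π : proj₁ π ≡ proj₁ π′
    same-π = increasing-unique π π′ (Rep⇒increasing π k rep) (Rep⇒increasing π′ k′ rep′)
    same-μ : ∀ i → μ (shift π k) i ≡ μ (shift π′ k′) i
    same-μ i = trans (sym (Rep⇒μ π k λv rep i))
      (trans (cong (λ v → + lookup λv (lookup v i)) same-π) (Rep⇒μ π′ k′ λv rep′ i))
    same-k : ∀ j → lookup k j ≡ lookup k′ j
    same-k j = ℕP.+-cancelʳ-≡ _ (lookup k j) (lookup k′ j)
      (trans (ℤP.+-injective (μ-injective (shift π k) (shift π′ k′) same-μ j))
             (cong (λ v → lookup k′ j ℕ.+ dind v j) (sym same-π)))

  -- For λ ∈ L, take π₀ the sorting permutation and k₀ = gaps − d_{π₀}.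
  module Existence (inL : InL a λv) where

    π₀ : Perm n
    π₀ = sorter

    v₀ : Vec (Fin n) n
    v₀ = proj₁ π₀

    ν : Fin n → ℕ
    ν i = lookup λv (app π₀ i)

    descending : ∀ t → ν (fsuc t) ≤ ν (inject₁ t)
    descending t = ≺⇒≥ (sorter-increasing t)

    gap : Fin n → ℕ
    gap j with lastView j
    ... | last = ℤ.∣ sumFin (λ i → a i * + ν i) ∣
    ... | inner t = ν (inject₁ t) ∸ ν (fsuc t)

    gap-inner : ∀ t → + gap (inject₁ t) ≡ + ν (inject₁ t) - + ν (fsuc t)
    gap-inner t rewrite lastView-inner t = sym (minus-∸ (descending t))

    gap-last : + gap lastᶠ ≡ sumFin (λ i → a i * + ν i)
    gap-last rewrite lastView-last {N} = ℤP.0≤i⇒+∣i∣≡i (inL π₀)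

    -- at a descent the sorted sequence strictly decreases
    dind≤gap : ∀ j → dind v₀ j ≤ gap j
    dind≤gap j with lastView j
    ... | last rewrite dind-last v₀ = z≤n
    ... | inner t rewrite dind-inner v₀ t with descent v₀ t in d
    ...   | false = z≤n
    ...   | true = ℕP.m+n≤o⇒m≤o∸n 1 (≺⇒> (sorter-increasing t) (ℕP.<ᵇ⇒< _ _ (subst T (sym d) tt)))

    k₀ : Vec ℕ n
    k₀ = tabulate (λ j → gap j ∸ dind v₀ j)

    shift≡gap : ∀ j → shift π₀ k₀ j ≡ + gap j
    shift≡gap j = cong +_ (trans (cong (ℕ._+ dind v₀ j) (VecP.lookup∘tabulate (λ j → gap j ∸ dind v₀ j) j))
                                 (ℕP.m∸n+n≡m (dind≤gap j)))

    rep₀ : Rep a π₀ k₀ λv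
    rep₀ = μ⇒Rep π₀ k₀ λv (λ i → sym (μ-solve (λ i → + ν i) (shift π₀ k₀)
      (λ t → trans (shift≡gap (inject₁ t)) (gap-inner t)) (trans (shift≡gap lastᶠ) gap-last) i))

  unique-representation : InL a λv → Σ (Perm n) (λ π → Σ (Vec ℕ n) (λ k → Rep a π k λv ×
    ((π′ : Perm n) (k′ : Vec ℕ n) → Rep a π′ k′ λv → (proj₁ π ≡ proj₁ π′) × (k ≡ k′))))
  unique-representation ∈L = π₀ , k₀ , rep₀ , λ π′ k′ → Rep-unique π₀ k₀ π′ k′ rep₀
    where open Existence ∈L

-- The m-th coefficient of F(q) counts the λ ∈ L with
-- |λ| = m.  By the bijection, each such λ is the exponent vector Λ(π, k) of
-- exactly one term, and |Λ(π, k)| = D(π) + Σⱼ kⱼ Cⱼ, where Cⱼ is the j-th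
-- column sum of b and D(π) = Σ_{j ∈ D_π} Cⱼ.  Hence F(q) = Σ_π q^{D(π)} ∏ⱼ
-- 1/(1 − q^{Cⱼ}); since ∏ⱼ (1 − q^{Cⱼ}) is the denominator and D(π) the
-- exponent of the numerator, F(q) · denominator = numerator.

module Counting (N : ℕ) (a : Fin (suc N) → ℤ) (Σa≡1 : sumFin a ≡ 1ℤ) (sorted : Sorted a) where

  open Matrix N a Σa≡1
  open Positivity N a Σa≡1 sorted

  C : Fin n → ℕ
  C j = ℤ.∣ colSum j ∣

  C≡colSum : ∀ j → + C j ≡ colSum j
  C≡colSum j = ℤP.0≤i⇒+∣i∣≡i (ℤP.≤-trans (ℤ.+≤+ z≤n) (colSum-pos j))

  C-pos : ∀ j → 1 ≤ C j
  C-pos j = ℤP.drop‿+≤+ (subst (1ℤ ℤ.≤_) (sym (C≡colSum j)) (colSum-pos j))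

  exponent-nonneg : ∀ π k u → 0ℤ ℤ.≤ exponent π (shift π k) u
  exponent-nonneg π k u = subst (λ w → 0ℤ ℤ.≤ exponent π (shift π k) w) (inv-r (app π) πinj u)
    (subst (0ℤ ℤ.≤_) (sym (exponent-at π (shift π k) i))
      (sumFin-nonneg _ (λ j → *-nonneg {shift π k j} (ℤ.+≤+ z≤n) (b-nonneg i j))))
    where
    πinj = perm-injective π
    i = inv (app π) πinj u

  -- The exponent vector Λ(v, k) of the k-th term of the v-term, for v in
  -- one-line notation; for a permutation it is `exponent`.
  Λ-entry : Vec (Fin n) n → Vec ℕ n → Fin n → ℕ
  Λ-entry v k u = ℤ.∣ sumFin (λ j → + (lookup k j ℕ.+ dind v j) * sumFin (λ i → select (lookup v i) u (bcoef a i j))) ∣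

  Λ : Vec (Fin n) n → Vec ℕ n → Vec ℕ n
  Λ v k = tabulate (Λ-entry v k)

  Λ⇒Rep : ∀ π k λv → λv ≡ Λ (proj₁ π) k → Rep a π k λv
  Λ⇒Rep π k λv refl u = trans (cong +_ (VecP.lookup∘tabulate (Λ-entry (proj₁ π) k) u)) (ℤP.0≤i⇒+∣i∣≡i (exponent-nonneg π k u))

  Rep⇒Λ : ∀ π k λv → Rep a π k λv → λv ≡ Λ (proj₁ π) k
  Rep⇒Λ π k λv rep = vec-ext λv (Λ (proj₁ π) k)
    (λ u → trans (cong ℤ.∣_∣ (rep u)) (sym (VecP.lookup∘tabulate (Λ-entry (proj₁ π) k) u)))

  D : Vec (Fin n) n → ℕ
  D v = sumℕ (λ j → dind v j ℕ.* C j)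

  W : Vec ℕ n → ℕ
  W k = sumℕ (λ j → lookup k j ℕ.* C j)

  weight : ∀ π k → sumℕ (lookup (Λ (proj₁ π) k)) ≡ D (proj₁ π) ℕ.+ W k
  weight π k = ℤP.+-injective (begin
    + sumℕ (lookup (Λ v k))
      ≡⟨ sumℕ≡sumFin (lookup (Λ v k)) ⟩
    sumFin (λ u → + lookup (Λ v k) u)
      ≡⟨ sumFin-cong (λ u → Λ⇒Rep π k (Λ v k) refl u) ⟩
    sumFin (exponent π c)
      ≡⟨ sumFin-reindex (app π) (perm-injective π) (exponent π c) ⟨
    sumFin (λ i → exponent π c (app π i))
      ≡⟨ trans (sumFin-cong (exponent-at π c)) (sumFin-μ c) ⟩
    sumFin (λ j → c j * colSum j)
      ≡⟨ sumFin-cong (λ j → trans (cong (c j *_) (sym (C≡colSum j))) (split j)) ⟩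
    sumFin (λ j → + (dind v j ℕ.* C j) + + (lookup k j ℕ.* C j))
      ≡⟨ sumFin-+ (λ j → + (dind v j ℕ.* C j)) (λ j → + (lookup k j ℕ.* C j)) ⟩
    sumFin (λ j → + (dind v j ℕ.* C j)) + sumFin (λ j → + (lookup k j ℕ.* C j))
      ≡⟨ cong₂ _+_ (sumℕ≡sumFin (λ j → dind v j ℕ.* C j)) (sumℕ≡sumFin (λ j → lookup k j ℕ.* C j)) ⟨
    + D v + + W k ∎)
    where
    open ≡-Reasoning
    v = proj₁ π
    c = shift π k
    split : ∀ j → c j * + C j ≡ + (dind v j ℕ.* C j) + + (lookup k j ℕ.* C j)
    split j = trans (sym (ℤP.pos-* (lookup k j ℕ.+ dind v j) (C j)))
      (trans (cong +_ (trans (ℕP.*-distribʳ-+ (C j) (lookup k j) (dind v j)) (ℕP.+-comm (lookup k j ℕ.* C j) (dind v j ℕ.* C j))))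
             (ℤP.pos-+ (dind v j ℕ.* C j) (lookup k j ℕ.* C j)))

  terms : ℕ → Vec ℕ n → ℤ
  terms m λv = sumL (perms n) (λ v → sumL (box n m) (λ k → 𝟙 (λv ≟ⁿ Λ v k)))

  -- If λ ∉ L there is none, since a representation would put λ in L ...
  terms-∉L : ∀ m λv → ¬ InL a λv → terms m λv ≡ 0ℤ
  terms-∉L m λv ∉L = trans (sumL-cong∈ (perms n) (λ v v∈ → trans (sumL-cong (box n m) (no-term v v∈)) (sumL-0 (box n m))))
                           (sumL-0 (perms n))
    where
    no-term : ∀ v → v ∈ perms n → ∀ k → 𝟙 (λv ≟ⁿ Λ v k) ≡ 0ℤ
    no-term v v∈ k = 𝟙-no (λv ≟ⁿ Λ v k) (λ e → ∉L (Rep⇒InL π k λv (Λ⇒Rep π k λv e)))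
      where π = v , ∈perms⇒isPerm v∈

  terms-∈L : ∀ m λv → λv ∈ comps n m → InL a λv → terms m λv ≡ 1ℤ
  terms-∈L m λv λ∈ ∈L = begin
    terms m λv
      ≡⟨ sumL-cong∈ (perms n) (λ v v∈ → trans (sumL-cong (box n m) (only-term v v∈))
                                            (sumL-*ˡ (box n m) (𝟙 (v ≟ᶠ v₀)) (λ k → 𝟙 (k ≟ⁿ k₀)))) ⟩
    sumL (perms n) (λ v → 𝟙 (v ≟ᶠ v₀) * Σk)
      ≡⟨ sumL-cong (perms n) (λ v → ℤP.*-comm (𝟙 (v ≟ᶠ v₀)) Σk) ⟩
    sumL (perms n) (λ v → Σk * 𝟙 (v ≟ᶠ v₀))
      ≡⟨ sumL-*ˡ (perms n) Σk (λ v → 𝟙 (v ≟ᶠ v₀)) ⟩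
    Σk * sumL (perms n) (λ v → 𝟙 (v ≟ᶠ v₀))
      ≡⟨ cong₂ _*_ (box-once n m k₀ k₀-bounded) (perms-once π₀) ⟩
    1ℤ ∎
    where
    open ≡-Reasoning
    open Bijection N a Σa≡1 sorted λv
    open Existence ∈L
    Σk = sumL (box n m) (λ k → 𝟙 (k ≟ⁿ k₀))
    only-term : ∀ v → v ∈ perms n → ∀ k → 𝟙 (λv ≟ⁿ Λ v k) ≡ 𝟙 (v ≟ᶠ v₀) * 𝟙 (k ≟ⁿ k₀)
    only-term v v∈ k = trans (𝟙-⇔ (λv ≟ⁿ Λ v k) ((v ≟ᶠ v₀) ×-dec (k ≟ⁿ k₀)) unique existing)
                             ([∧] (does (v ≟ᶠ v₀)) (does (k ≟ⁿ k₀)))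
      where
      π = v , ∈perms⇒isPerm v∈
      unique : λv ≡ Λ v k → (v ≡ v₀) × (k ≡ k₀)
      unique e = let same = Rep-unique π₀ k₀ π k rep₀ (Λ⇒Rep π k λv e) in sym (proj₁ same) , sym (proj₂ same)
      existing : (v ≡ v₀) × (k ≡ k₀) → λv ≡ Λ v k
      existing (refl , refl) = Rep⇒Λ π₀ k₀ λv rep₀
    -- kⱼ ≤ kⱼ Cⱼ ≤ |Λ(π₀, k₀)| = |λ| = m
    k₀-bounded : ∀ j → lookup k₀ j ≤ m
    k₀-bounded j = ℕP.≤-trans (ℕP.m≤m*n (lookup k₀ j) (C j) {{ℕ.>-nonZero (C-pos j)}})
      (ℕP.≤-trans (sumℕ-term (λ j → lookup k₀ j ℕ.* C j) j)
      (ℕP.≤-trans (ℕP.m≤n+m (W k₀) (D v₀))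
                  (ℕP.≤-reflexive (trans (sym (weight π₀ k₀))
                    (trans (cong (sumℕ ∘ lookup) (sym (Rep⇒Λ π₀ k₀ λv rep₀))) (∈comps⇒sum n m λv λ∈))))))

  representations : ∀ m λv → λv ∈ comps n m → terms m λv ≡ [ inLᵇ a λv ]ᵇ
  representations m λv λ∈ with inLᵇ a λv in inL?
  ... | false = terms-∉L m λv (λ ∈L → subst T inL? (InL⇒inLᵇ a λv ∈L))
  ... | true = terms-∈L m λv λ∈ (inLᵇ⇒InL a λv (subst T (sym inL?) tt))

  Q : Series
  Q = geometrics (List.tabulate C)

  Fq-expansion : ∀ m → Fq a m ≡ sumL (perms n) (λ v → (monoS (+ D v) ⊛ Q) m)
  Fq-expansion m = begin
    Fq a m
      ≡⟨ length-filter (comps n m) (inLᵇ a) ⟩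
    sumL (comps n m) (λ λv → [ inLᵇ a λv ]ᵇ)
      ≡⟨ sumL-cong∈ (comps n m) (λ λv λ∈ → sym (representations m λv λ∈)) ⟩
    sumL (comps n m) (λ λv → sumL V (λ v → sumL K (λ k → 𝟙 (λv ≟ⁿ Λ v k))))
      ≡⟨ sumL-swap (comps n m) V _ ⟩
    sumL V (λ v → sumL (comps n m) (λ λv → sumL K (λ k → 𝟙 (λv ≟ⁿ Λ v k))))
      ≡⟨ sumL-cong V (λ v → sumL-swap (comps n m) K _) ⟩
    sumL V (λ v → sumL K (λ k → sumL (comps n m) (λ λv → 𝟙 (λv ≟ⁿ Λ v k))))
      ≡⟨ sumL-cong V (λ v → sumL-cong K (λ k → comps-count n m (Λ v k))) ⟩
    sumL V (λ v → sumL K (λ k → 𝟙 (sumℕ (lookup (Λ v k)) ℕP.≟ m)))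
      ≡⟨ sumL-cong∈ V (λ v v∈ → sumL-cong K (λ k → cong (λ s → 𝟙 (s ℕP.≟ m)) (weight (v , ∈perms⇒isPerm v∈) k))) ⟩
    sumL V (λ v → sumL K (λ k → 𝟙 (D v ℕ.+ W k ℕP.≟ m)))
      ≡⟨ sumL-cong V (λ v → solutions n C C-pos m (D v) m ℕP.≤-refl) ⟩
    sumL V (λ v → if D v ≤ᵇ m then Q (m ∸ D v) else 0ℤ)
      ≡⟨ sumL-cong V (λ v → sym (⊛-mono (D v) Q m)) ⟩
    sumL V (λ v → (monoS (+ D v) ⊛ Q) m) ∎
    where
    open ≡-Reasoning
    V = perms n
    K = box n m

  oneMinusC : Fin n → Series
  oneMinusC j = oneMinus (+ C j)

  denS-columns : denS a ≗ₛ prodS (List.map oneMinusC (allFin n))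
  denS-columns = ≗ₛ-trans (mulS≗⊛ (oneMinus (+ n)) others)
    (≗ₛ-trans (⊛-cong (λ m → cong (λ x → oneMinus (+ x) m) (sym C-last)) others≗)
    (≗ₛ-sym (≗ₛ-trans (λ m → cong (λ xs → prodS (List.map oneMinusC xs) m) (tabulate-snoc (λ j → j)))
                      (prodS-snoc (List.tabulate inject₁) lastᶠ oneMinusC))))
    where
    others = prodS (List.map (λ j → oneMinus (cexp a j)) (filterᵇ (λ j → suc (toℕ j) <ᵇ n) (allFin n)))
    C-last : C lastᶠ ≡ n
    C-last = ℤP.+-injective (trans (C≡colSum lastᶠ) colSum-last)
    non-last : filterᵇ (λ j → suc (toℕ j) <ᵇ n) (allFin n) ≡ List.tabulate inject₁
    non-last = begin
      filterᵇ p (allFin n)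
        ≡⟨ cong (filterᵇ p) (tabulate-snoc (λ j → j)) ⟩
      filterᵇ p (List.tabulate inject₁ ++ lastᶠ ∷ [])
        ≡⟨ ListP.filter-++ (T? ∘ p) (List.tabulate inject₁) _ ⟩
      filterᵇ p (List.tabulate inject₁) ++ filterᵇ p (lastᶠ ∷ [])
        ≡⟨ cong₂ _++_ (ListP.filter-all (T? ∘ p) (AllP.tabulate⁺ kept)) (ListP.filter-none (T? ∘ p) (dropped All.∷ All.[])) ⟩
      List.tabulate inject₁ ++ []
        ≡⟨ ListP.++-identityʳ _ ⟩
      List.tabulate inject₁ ∎
      where
      open ≡-Reasoning
      p : Fin n → Bool
      p j = suc (toℕ j) <ᵇ n
      kept : ∀ t → T (p (inject₁ t))
      kept t = subst T (sym (<ᵇ-true (subst (ℕ._< N) (sym (FinP.toℕ-inject₁ t)) (FinP.toℕ<n t)))) tt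
      dropped : ¬ T (p lastᶠ)
      dropped h = ℕP.<-irrefl (FinP.toℕ-fromℕ N) (ℕP.<ᵇ⇒< _ _ h)
    others≗ : others ≗ₛ prodS (List.map oneMinusC (List.tabulate inject₁))
    others≗ m = begin
      others m
        ≡⟨ cong (λ xs → prodS (List.map (λ j → oneMinus (cexp a j)) xs) m) non-last ⟩
      prodS (List.map (λ j → oneMinus (cexp a j)) (List.tabulate inject₁)) m
        ≡⟨ cong (λ xs → prodS xs m) (reindex (λ j → oneMinus (cexp a j))) ⟩
      prodS (List.map (λ t → oneMinus (cexp a (inject₁ t))) (allFin N)) m
        ≡⟨ prodS-cong (allFin N) (λ t → oneMinus (cexp a (inject₁ t))) (oneMinusC ∘ inject₁) same-factor m ⟩
      prodS (List.map (oneMinusC ∘ inject₁) (allFin N)) m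
        ≡⟨ cong (λ xs → prodS xs m) (sym (reindex oneMinusC)) ⟩
      prodS (List.map oneMinusC (List.tabulate inject₁)) m ∎
      where
      open ≡-Reasoning
      reindex : (F : Fin n → Series) → List.map F (List.tabulate inject₁) ≡ List.map (F ∘ inject₁) (allFin N)
      reindex F = trans (ListP.map-tabulate inject₁ F) (sym (ListP.map-tabulate (λ t → t) (F ∘ inject₁)))
      same-factor : ∀ t → oneMinus (cexp a (inject₁ t)) ≗ₛ oneMinusC (inject₁ t)
      same-factor t m′ = cong (λ x → oneMinus x m′) (sym (trans (C≡colSum (inject₁ t)) (colSum-inner t)))

  numerator-exponent : ∀ v → sumFin (λ j → + dind v j * cexp a j) ≡ + D v
  numerator-exponent v = sym (trans (sumℕ≡sumFin (λ j → dind v j ℕ.* C j)) (sumFin-cong term))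
    where
    term : ∀ j → + (dind v j ℕ.* C j) ≡ + dind v j * cexp a j
    term j with lastView j
    ... | last rewrite dind-last v = refl
    ... | inner t = trans (ℤP.pos-* (dind v (inject₁ t)) (C (inject₁ t)))
                          (cong (+ dind v (inject₁ t) *_) (trans (C≡colSum (inject₁ t)) (colSum-inner t)))

  generating-function : ∀ m → mulS (Fq a) (denS a) m ≡ numS a m
  generating-function m = begin
    mulS (Fq a) (denS a) m
      ≡⟨ mulS≗⊛ (Fq a) (denS a) m ⟩
    (Fq a ⊛ denS a) m
      ≡⟨ ⊛-cong Fq-expansion denS-columns m ⟩
    (FS ⊛ Den) m
      ≡⟨ sumL-⊛ (perms n) (λ v → monoS (+ D v) ⊛ Q) Den m ⟩
    sumL (perms n) (λ v → (monoS (+ D v) ⊛ Q ⊛ Den) m)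
      ≡⟨ sumL-cong (perms n) (λ v → ⊛-assoc (monoS (+ D v)) Q Den m) ⟩
    sumL (perms n) (λ v → (monoS (+ D v) ⊛ (Q ⊛ Den)) m)
      ≡⟨ sumL-cong (perms n) (λ v → trans (⊛-cong {f = monoS (+ D v)} (λ _ → refl) Q⊛Den≗1 m) (⊛-oneS (monoS (+ D v)) m)) ⟩
    sumL (perms n) (λ v → monoS (+ D v) m)
      ≡⟨ sumL-cong (perms n) (λ v → cong (λ e → monoS e m) (sym (numerator-exponent v))) ⟩
    numS a m ∎
    where
    open ≡-Reasoning
    FS : Series
    FS m = sumL (perms n) (λ v → (monoS (+ D v) ⊛ Q) m)
    Den : Series
    Den = prodS (List.map oneMinusC (allFin n))
    Q⊛Den≗1 : Q ⊛ Den ≗ₛ oneS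
    Q⊛Den≗1 = subst (λ cs → geometrics cs ⊛ Den ≗ₛ oneS) (ListP.map-tabulate (λ j → j) C)
                    (geometrics-inverse (allFin n) C C-pos)

theorem1 : (n : ℕ) → 1 ≤ n → (a : Fin n → ℤ) → Sorted a → sumFin a ≡ 1ℤ →
    ((λv : Vec ℕ n) →
      (InL a λv → Σ (Perm n) (λ π → Σ (Vec ℕ n) (λ k → Rep a π k λv ×
          ((π′ : Perm n) (k′ : Vec ℕ n) → Rep a π′ k′ λv → (proj₁ π ≡ proj₁ π′) × (k ≡ k′)))))
      × (¬ InL a λv → (π : Perm n) (k : Vec ℕ n) → ¬ Rep a π k λv))
    × ((m : ℕ) → mulS (Fq a) (denS a) m ≡ numS a m)
theorem1 zero () a sorted Σa≡1
theorem1 (suc N) (s≤s z≤n) a sorted Σa≡1 =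
  (λ λv → unique-representation λv , (λ ∉L π k rep → ∉L (Rep⇒InL π k λv rep))) , generating-function
  where
  open Positivity N a Σa≡1 sorted using (Rep⇒InL)
  open Bijection N a Σa≡1 sorted using (unique-representation)
  open Counting N a Σa≡1 sorted using (generating-function)
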